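{- Let $1\le\alpha<2$. In general, the Adaptive Exploration Algorithm does not achieve a competitive ratio better than $\alpha$ on GEEWE instances in which every edge is announced with the interval $[1,\alpha]$: for every $c<\alpha$ there exists such an instance on which the cost of the Adaptive Exploration Algorithm exceeds $c\cdot\mathrm{OPT}$.
   Context: Graph Exploration with Edge Weight Estimates (GEEWE): An instance consists of a connected graph $G=(V,E)$, for every edge $e$ a lower bound $\ell(e)$ and an upper bound $u(e)$, a start vertex $s$ and a distinct end vertex $t$, and actual weights $w(e)\in[\ell(e),u(e)]$. The graph and bounds are known in advance; $w(e)$ is revealed as soon as the agent visits a vertex incident to $e$. The agent, starting at $s$, must perform a walk (repetitions allowed) from $s$ to $t$ visiting all vertices; its cost is the sum of actual weights of traversed edges with multiplicity; $\mathrm{OPT}$ is the minimum such cost when all actual weights are known. Adaptive Exploration Algorithm: while not all vertices have been visited, the agent computes a shortest walk from its current vertex to $t$ visiting all unvisited vertices, using actual weights for revealed edges and upper bounds $u(e)$ for unrevealed edges, and moves to the next vertex on that walk.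
   Formalization: The parameters α and c range over ℚ, and the lower bounds, upper bounds and actual edge weights of the constructed instance are taken in ℚ. -}

module Defs where

open import Data.Nat using (ℕ)
open import Data.Integer using (+_)
open import Data.Fin using (Fin)
open import Data.Fin.Properties using () renaming (_≟_ to _≟ᶠ_)
open import Data.Bool using (Bool; true; false; if_then_else_; _∨_)
open import Data.List using (List; []; _∷_)
open import Data.List.Membership.Propositional using (_∈_)
open import Data.List.Membership.DecPropositional using () renaming (_∈?_ to mem?)
open import Data.Product using (Σ; _×_; _,_; ∃)
open import Data.Unit using (⊤)
open import Data.Rational using (ℚ; _+_; _*_; _≤_; _<_; 0ℚ; 1ℚ; _/_)
open import Relation.Nullary using (¬_; does)
open import Relation.Binary.PropositionalEquality using (_≡_; _≢_)

2ℚ : ℚ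
2ℚ = + 2 / 1

-- a walk starting at u, given by the list of subsequent vertices
Steps : {n : ℕ} → (Fin n → Fin n → Bool) → Fin n → List (Fin n) → Set
Steps adj u []       = ⊤
Steps adj u (x ∷ xs) = (adj u x ≡ true) × Steps adj x xs

endAt : {n : ℕ} → Fin n → List (Fin n) → Fin n
endAt u []       = u
endAt u (x ∷ xs) = endAt x xs

cost : {n : ℕ} → (Fin n → Fin n → ℚ) → Fin n → List (Fin n) → ℚ
cost f u []       = 0ℚ
cost f u (x ∷ xs) = f u x + cost f x xs

-- Bounds and weights are
-- functions on ordered vertex pairs, symmetric; only their values on edges matter.
record Instance : Set where
  field
    n      : ℕ
    adj    : Fin n → Fin n → Bool
    adj-sym  : ∀ x y → adj x y ≡ adj y x
    adj-irr  : ∀ x → adj x x ≡ false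
    lo up w  : Fin n → Fin n → ℚ
    lo-sym : ∀ x y → lo x y ≡ lo y x
    up-sym : ∀ x y → up x y ≡ up y x
    w-sym  : ∀ x y → w x y ≡ w y x
    w-lo   : ∀ x y → adj x y ≡ true → lo x y ≤ w x y
    w-up   : ∀ x y → adj x y ≡ true → w x y ≤ up x y
    s t    : Fin n
    s≢t    : s ≢ t

    connected : ∀ x y → Σ (List (Fin n)) λ xs → Steps adj x xs × endAt x xs ≡ y

  V : Set
  V = Fin n

Announced : Instance → ℚ → Set
Announced I α = ∀ x y → adj x y ≡ true → (lo x y ≡ 1ℚ) × (up x y ≡ α)
  where open Instance I

module _ (I : Instance) where
  open Instance I

  Tour : List V → Set
  Tour xs = Steps adj s xs × endAt s xs ≡ t × (∀ v → v ∈ s ∷ xs)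

  IsOPT : ℚ → Set
  IsOPT o = (Σ (List V) λ xs → Tour xs × cost w s xs ≡ o)
          × (∀ xs → Tour xs → o ≤ cost w s xs)

  -- weight estimate given the set of visited vertices: actual weight for
  -- revealed edges (incident to a visited vertex), upper bound otherwise
  est : List V → V → V → ℚ
  est vis x y =
    if does (mem? _≟ᶠ_ x vis) ∨ does (mem? _≟ᶠ_ y vis) then w x y else up x y

  Feasible : List V → V → List V → Set
  Feasible vis u xs =
    Steps adj u xs × endAt u xs ≡ t × (∀ v → ¬ (v ∈ vis) → v ∈ u ∷ xs)

  -- one step of the Adaptive Exploration Algorithm: from current vertex u
  -- (visited set vis), move to the next vertex v of some shortest (w.r.t. est)
  -- walk from u to t visiting all unvisited vertices
  Move : List V → V → V → Set
  Move vis u v = Σ (List V) λ xs → Feasible vis u (v ∷ xs)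
    × (∀ ys → Feasible vis u ys → cost (est vis) u (v ∷ xs) ≤ cost (est vis) u ys)

  data Run : List V → V → List V → Set where
    done : ∀ {vis u} → u ≡ t → (∀ v → v ∈ vis) → Run vis u []
    step : ∀ {vis u v ms} → Move vis u v → Run (v ∷ vis) v ms → Run vis u (v ∷ ms)

  AlgRun : List V → Set
  AlgRun ms = Run (s ∷ []) s ms

  algCost : List V → ℚ
  algCost ms = cost w s ms

-- The instance is a ladder with rails s, e₁, …, e_k and d_{k-1}, …, d₁, t, whose rail edges
-- cost α while the rungs e_j–d_j, the diagonals e_{j+1}–d_j and the edges s–e₁, e₁–t cost 1,
-- plus a chord s–e_k of cost α. The algorithm prices unrevealed edges at α, so from e_i the
-- revealed cheap edges into the d-rail do not pay off: the unexplored top of the ladder could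
-- then only be left again at an extra cost. It climbs the e-rail and descends the d-rail,
-- paying 2 + (2k-2)α, while the optimum takes the chord and zig-zags down on cost-1 edges,
-- paying α + 2k - 1. All lower bounds on walks come from potential functions; for 1 < α < 2
-- they are strict for every deviation, so the run is unique, and a large k beats any c < α.
-- (For c < 1 it suffices that every run costs at least OPT > c·OPT.)

module Submission where

open import Defs
open import Data.List using (List)
open import Data.Product using (Σ; _×_)
open import Data.Rational using (ℚ; _*_; _≤_; _<_; 1ℚ)

open import Algebra.Bundles using (CommutativeMonoid; Ring)
open import Data.Bool using (Bool; true; false; if_then_else_; _∨_)
open import Data.Bool.Properties using (∨-comm)
open import Data.Empty using (⊥; ⊥-elim)
open import Data.Fin using (Fin; toℕ; fromℕ<)
open import Data.Fin.Properties using (toℕ-fromℕ<; toℕ-injective; toℕ≤pred[n]) renaming (_≟_ to _≟ᶠ_)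
import Data.Integer as ℤ
import Data.Integer.Properties as ℤ
import Data.Integer.Solver as ℤ-Solver
open import Data.List using ([]; _∷_; _++_; length; filter)
import Data.List.Membership.DecPropositional as DecMembership
open import Data.List.Membership.DecPropositional using () renaming (_∈?_ to mem?)
open import Data.List.Membership.Propositional using (_∈_; _∉_; find; lose)
open import Data.List.Membership.Propositional.Properties using (∈-filter⁺; ∈-filter⁻)
open import Data.List.Properties using (filter-all; filter-accept; filter-reject)
open import Data.List.Relation.Binary.Subset.Propositional using (_⊆_)
open import Data.List.Relation.Unary.All as All using (All; []; _∷_)
import Data.List.Relation.Unary.All.Properties as All
open import Data.List.Relation.Unary.Any using (Any; here; there; any?)
open import Data.List.Relation.Unary.Unique.Propositional using (Unique; []; _∷_)
import Data.List.Relation.Unary.Unique.Propositional.Properties as Unique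
open import Data.Nat as ℕ using (ℕ; zero; suc; z≤n; s≤s; ⌊_/2⌋)
import Data.Nat.Properties as ℕ
open import Data.Product using (_,_; proj₁; proj₂)
open import Data.Rational using (mkℚ; _+_; _-_; -_; 0ℚ; ½; toℚᵘ; 1/_; positive; nonNegative; NonZero)
import Data.Rational.Properties as ℚ
open import Data.Rational.Solver using (module +-*-Solver)
open import Data.Rational.Unnormalised as ℚᵘ using (mkℚᵘ; *≤*; *≡*)
import Data.Rational.Unnormalised.Properties as ℚᵘ
open import Data.Sum using (_⊎_; inj₁; inj₂; [_,_]′)
open import Data.Unit using (⊤; tt)
open import Function using (_∘_)
open import Level using (0ℓ)
open import Relation.Binary using (Rel) renaming (Decidable to Decidable₂)
open import Relation.Binary.Definitions using (DecidableEquality; tri<; tri≈; tri>)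
open import Relation.Binary.PropositionalEquality using (_≡_; _≢_; refl; sym; cong; cong₂; trans; subst; subst₂)
open import Relation.Nullary using (¬_; Dec; yes; no; ¬?; does; proof; contradiction)
open import Relation.Nullary.Decidable using (map′; dec-true; dec-false; _⊎-dec_; _×-dec_)
open import Relation.Nullary.Reflects using (invert)
open import Relation.Unary using (Pred; Decidable)

open import Algebra.Properties.Semiring.Mult (Ring.semiring ℚ.+-*-ring) using (×-homo-+; ×-assoc-*) renaming (_×_ to _·_)
open import Algebra.Properties.CommutativeSemigroup
  (CommutativeMonoid.commutativeSemigroup ℚ.+-0-commutativeMonoid) using (x∙yz≈y∙xz; xy∙z≈y∙xz)

module Removal {A : Set} (_≟_ : DecidableEquality A) where

  infixl 5 _∖_

  _∖_ : List A → A → List A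
  R ∖ x = filter (λ y → ¬? (y ≟ x)) R

  ∈-∖⁻ : ∀ {x y R} → y ∈ R ∖ x → y ∈ R × y ≢ x
  ∈-∖⁻ {x} = ∈-filter⁻ (λ y → ¬? (y ≟ x))

  ∈-∖⁺ : ∀ {x y R} → y ∈ R → y ≢ x → y ∈ R ∖ x
  ∈-∖⁺ {x} = ∈-filter⁺ (λ y → ¬? (y ≟ x))

  unique-∖ : ∀ {x R} → Unique R → Unique (R ∖ x)
  unique-∖ {x} = Unique.filter⁺ (λ y → ¬? (y ≟ x))

  all-∖ : ∀ {ℓ} {P : Pred A ℓ} {x R} → All P R → All P (R ∖ x)
  all-∖ {x = x} = All.filter⁺ (λ y → ¬? (y ≟ x))

  ∉-∖ : ∀ {x y R} → y ∉ R → y ∉ R ∖ x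
  ∉-∖ {x} {R = R} y∉R y∈R∖x = y∉R (proj₁ (∈-∖⁻ {x} {R = R} y∈R∖x))

  any-∖⁺ : ∀ {ℓ} {P : Pred A ℓ} {x R} → ¬ P x → Any P R → Any P (R ∖ x)
  any-∖⁺ ¬Px pR with find pR
  ... | y , y∈R , Py = lose (∈-∖⁺ y∈R λ { refl → ¬Px Py }) Py

  any-∖⁻ : ∀ {ℓ} {P : Pred A ℓ} {x R} → Any P (R ∖ x) → Any P R
  any-∖⁻ {x = x} {R} pR∖x with find pR∖x
  ... | y , y∈R∖x , Py = lose (proj₁ (∈-∖⁻ {x} {R = R} y∈R∖x)) Py

  length-∖ : ∀ {x R} → Unique R → x ∈ R → length R ≡ suc (length (R ∖ x))
  length-∖ {x} {x ∷ R} (x∉R ∷ _) (here refl) = cong (suc ∘ length) (sym R∖x≡R)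
    where
    R∖x≡R : (x ∷ R) ∖ x ≡ R
    R∖x≡R = trans (filter-reject (λ y → ¬? (y ≟ x)) (λ x≢x → x≢x refl))
                  (filter-all (λ y → ¬? (y ≟ x)) (All.map (λ x≢y y≡x → x≢y (sym y≡x)) x∉R))
  length-∖ {x} {y ∷ R} (y∉R ∷ uR) (there x∈R)
    rewrite filter-accept (λ z → ¬? (z ≟ x)) {xs = R} (All.lookup y∉R x∈R) = cong suc (length-∖ uR x∈R)

steps-++ : ∀ {n} {adj : Fin n → Fin n → Bool} {u} xs {ys} →
  Steps adj u xs → Steps adj (endAt u xs) ys → Steps adj u (xs ++ ys)
steps-++ [] _ steps = steps
steps-++ (x ∷ xs) (u~x , steps) steps′ = u~x , steps-++ xs steps steps′

endAt-++ : ∀ {n} (u : Fin n) xs ys → endAt u (xs ++ ys) ≡ endAt (endAt u xs) ys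
endAt-++ u [] ys = refl
endAt-++ u (x ∷ xs) ys = endAt-++ x xs ys

cost-++ : ∀ {n} (f : Fin n → Fin n → ℚ) u xs ys → cost f u (xs ++ ys) ≡ cost f u xs + cost f (endAt u xs) ys
cost-++ f u [] ys = sym (ℚ.+-identityˡ _)
cost-++ f u (x ∷ xs) ys = trans (cong (f u x +_) (cost-++ f x xs ys)) (sym (ℚ.+-assoc (f u x) _ _))

-- Lower bounds on walks from potentials

-- Φ p R bounds from below what a walk from p pays beyond a for each vertex of R it must still visit.
module PotentialMethod {n : ℕ} (adj : Fin n → Fin n → Bool) (t : Fin n)
  (f : Fin n → Fin n → ℚ) (a : ℚ) (New : Pred (Fin n) 0ℓ) (Φ : Fin n → List (Fin n) → ℚ) where

  open Removal (_≟ᶠ_ {n})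
  open DecMembership (_≟ᶠ_ {n}) using (_∈?_)
  open ℚ.≤-Reasoning

  Enter : Set
  Enter = ∀ {p x R} → adj p x ≡ true → p ∉ R → All New R → x ∈ R → a + Φ p R ≤ f p x + Φ x (R ∖ x)

  Pass : Set
  Pass = ∀ {p x R} → adj p x ≡ true → p ∉ R → All New R → x ∉ R → Φ p R ≤ f p x + Φ x R

  WalkBound : Set
  WalkBound = ∀ {p} xs {R} → Steps adj p xs → endAt p xs ≡ t → R ⊆ xs → Unique R → p ∉ R → All New R →
    length R · a + Φ p R ≤ cost f p xs

  potential-bound : Enter → Pass → Φ t [] ≤ 0ℚ → WalkBound
  potential-bound enter pass final [] {[]} _ refl _ _ _ _ = begin
    0ℚ + Φ t [] ≡⟨ ℚ.+-identityˡ _ ⟩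
    Φ t []      ≤⟨ final ⟩
    0ℚ          ∎
  potential-bound enter pass final [] {_ ∷ _} _ _ R⊆[] _ _ _ = contradiction (R⊆[] (here refl)) λ ()
  potential-bound enter pass final {p} (x ∷ xs) {R} (px , steps) end R⊆ uR p∉R newR with x ∈? R
  ... | yes x∈R = begin
    length R · a + Φ p R     ≡⟨ cong (λ l → l · a + Φ p R) (length-∖ uR x∈R) ⟩
    (a + M) + Φ p R          ≡⟨ xy∙z≈y∙xz a M (Φ p R) ⟩
    M + (a + Φ p R)          ≤⟨ ℚ.+-monoʳ-≤ M (enter px p∉R newR x∈R) ⟩
    M + (f p x + Φ x (R ∖ x)) ≡⟨ x∙yz≈y∙xz M (f p x) _ ⟩
    f p x + (M + Φ x (R ∖ x)) ≤⟨ ℚ.+-monoʳ-≤ (f p x) ih ⟩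
    f p x + cost f x xs      ∎
    where
    M : ℚ
    M = length (R ∖ x) · a
    R∖x⊆xs : R ∖ x ⊆ xs
    R∖x⊆xs {y} y∈R∖x with ∈-∖⁻ {x} {y} {R} y∈R∖x
    ... | y∈R , y≢x with R⊆ y∈R
    ...   | here y≡x = contradiction y≡x y≢x
    ...   | there y∈xs = y∈xs
    ih : M + Φ x (R ∖ x) ≤ cost f x xs
    ih = potential-bound enter pass final xs steps end R∖x⊆xs (unique-∖ uR)
           (λ x∈R∖x → proj₂ (∈-∖⁻ {x} {R = R} x∈R∖x) refl) (all-∖ newR)
  ... | no x∉R = begin
    L + Φ p R             ≤⟨ ℚ.+-monoʳ-≤ L (pass px p∉R newR x∉R) ⟩
    L + (f p x + Φ x R)   ≡⟨ x∙yz≈y∙xz L (f p x) _ ⟩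
    f p x + (L + Φ x R)   ≤⟨ ℚ.+-monoʳ-≤ (f p x) ih ⟩
    f p x + cost f x xs   ∎
    where
    L : ℚ
    L = length R · a
    R⊆xs : R ⊆ xs
    R⊆xs y∈R with R⊆ y∈R
    ... | here refl = contradiction y∈R x∉R
    ... | there y∈xs = y∈xs
    ih : L + Φ x R ≤ cost f x xs
    ih = potential-bound enter pass final xs steps end R⊆xs uR x∉R newR

-- Φ charges 1 to an unvisited vertex below the top while top vertices remain, and to a top vertex
-- once the gate g has been used: the walk still has to leave the top, which it can do only through
-- g or over an edge of cost α. A visited vertex with a cheap edge into R is credited 1 - α, the
-- saving of one cheap entry; a second one needs a return to a visited vertex, costing 1 ≥ α - 1.
module GatePotential
  {n : ℕ} (adj : Fin n → Fin n → Bool) (adj-sym : ∀ x y → adj x y ≡ adj y x) (t : Fin n)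
  (f : Fin n → Fin n → ℚ) (f-sym : ∀ x y → f x y ≡ f y x)
  {α : ℚ} (1≤α : 1ℚ ≤ α) (α≤2 : α ≤ 2ℚ)
  {Visited : Pred (Fin n) 0ℓ} (visited? : Decidable Visited)
  {Cheap : Rel (Fin n) 0ℓ} (cheap? : Decidable₂ Cheap)
  (f≥1 : ∀ {x y} → adj x y ≡ true → 1ℚ ≤ f x y)
  (f-dear : ∀ {x y} → adj x y ≡ true → ¬ Cheap x y → α ≤ f x y)
  (f-unvisited : ∀ {x y} → adj x y ≡ true → ¬ Visited x → ¬ Visited y → α ≤ f x y)
  {Top : Pred (Fin n) 0ℓ} (top? : Decidable Top) (g : Fin n)
  (top-exit : ∀ {x y} → Top x → adj x y ≡ true → ¬ Visited y → ¬ Top y → y ≡ g)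
  (top-sealed : ∀ {x y} → Top x → Visited y → adj x y ≡ true → α ≤ f x y)
  (t-not-top : ¬ Top t)
  where

  open Removal (_≟ᶠ_ {n})
  open DecMembership (_≟ᶠ_ {n}) using (_∈?_)
  open ℚ.≤-Reasoning

  α+[1-α]≡1 : α + (1ℚ - α) ≡ 1ℚ
  α+[1-α]≡1 = solve 1 (λ a → a :+ (con 1ℚ :- a) := con 1ℚ) refl α
    where open +-*-Solver

  1-α≤0 : 1ℚ - α ≤ 0ℚ
  1-α≤0 = begin
    1ℚ - α ≤⟨ ℚ.+-monoˡ-≤ (- α) 1≤α ⟩
    α - α  ≡⟨ ℚ.+-inverseʳ α ⟩
    0ℚ     ∎

  ≥1-+-≥0 : ∀ {a b} → 1ℚ ≤ a → 0ℚ ≤ b → 1ℚ ≤ a + b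
  ≥1-+-≥0 1≤a 0≤b = ℚ.+-mono-≤ 1≤a 0≤b

  ≥α-+-≥1-α : ∀ {a b} → α ≤ a → 1ℚ - α ≤ b → 1ℚ ≤ a + b
  ≥α-+-≥1-α {a} {b} α≤a 1-α≤b = begin
    1ℚ           ≡⟨ α+[1-α]≡1 ⟨
    α + (1ℚ - α) ≤⟨ ℚ.+-mono-≤ α≤a 1-α≤b ⟩
    a + b        ∎

  ≥1-+-≥1-α : ∀ {a b} → 1ℚ ≤ a → 1ℚ - α ≤ b → 0ℚ ≤ a + b
  ≥1-+-≥1-α {a} {b} 1≤a 1-α≤b = begin
    0ℚ              ≡⟨ ℚ.+-inverseʳ α ⟨
    α - α           ≤⟨ ℚ.+-monoˡ-≤ (- α) α≤2 ⟩
    2ℚ - α          ≡⟨ solve 1 (λ a → con 2ℚ :- a := con 1ℚ :+ (con 1ℚ :- a)) refl α ⟩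
    1ℚ + (1ℚ - α)   ≤⟨ ℚ.+-mono-≤ 1≤a 1-α≤b ⟩
    a + b           ∎
    where open +-*-Solver

  opaque
    Φ : Fin n → List (Fin n) → ℚ
    Φ p R with visited? p | top? p
    ... | yes _ | _     = if does (any? top? R) then 0ℚ else (if does (any? (cheap? p) R) then 1ℚ - α else 0ℚ)
    ... | no _  | yes _ = if does (g ∈? R) then 0ℚ else 1ℚ
    ... | no _  | no _  = if does (any? top? R) then 1ℚ else 0ℚ

    Φ-visited-≤0 : ∀ {p R} → Visited p → Φ p R ≤ 0ℚ
    Φ-visited-≤0 {p} {R} vp with visited? p | top? p
    ... | no ¬vp | _ = contradiction vp ¬vp
    ... | yes _ | _ with any? top? R | any? (cheap? p) R
    ...   | yes _ | _     = ℚ.≤-refl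
    ...   | no _  | yes _ = 1-α≤0
    ...   | no _  | no _  = ℚ.≤-refl

    Φ-visited-pending : ∀ {p R} → Visited p → Any Top R → Φ p R ≡ 0ℚ
    Φ-visited-pending {p} {R} vp pending with visited? p | top? p
    ... | no ¬vp | _ = contradiction vp ¬vp
    ... | yes _ | _ with any? top? R
    ...   | yes _ = refl
    ...   | no ¬pending = contradiction pending ¬pending

    Φ-visited-cheap : ∀ {p x R} → Visited p → ¬ Any Top R → x ∈ R → Cheap p x → Φ p R ≡ 1ℚ - α
    Φ-visited-cheap {p} {x} {R} vp ¬pending x∈R c with visited? p | top? p
    ... | no ¬vp | _ = contradiction vp ¬vp
    ... | yes _ | _ with any? top? R | any? (cheap? p) R
    ...   | yes pending | _ = contradiction pending ¬pending
    ...   | no _ | yes _ = refl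
    ...   | no _ | no ¬c = contradiction (lose x∈R c) ¬c

    Φ-top-open : ∀ {p R} → ¬ Visited p → Top p → g ∈ R → Φ p R ≡ 0ℚ
    Φ-top-open {p} {R} ¬vp tp g∈R with visited? p | top? p
    ... | yes vp | _ = contradiction vp ¬vp
    ... | no _ | no ¬tp = contradiction tp ¬tp
    ... | no _ | yes _ with g ∈? R
    ...   | yes _ = refl
    ...   | no g∉R = contradiction g∈R g∉R

    Φ-top-closed : ∀ {p R} → ¬ Visited p → Top p → g ∉ R → Φ p R ≡ 1ℚ
    Φ-top-closed {p} {R} ¬vp tp g∉R with visited? p | top? p
    ... | yes vp | _ = contradiction vp ¬vp
    ... | no _ | no ¬tp = contradiction tp ¬tp
    ... | no _ | yes _ with g ∈? R
    ...   | yes g∈R = contradiction g∈R g∉R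
    ...   | no _ = refl

    Φ-bottom-pending : ∀ {p R} → ¬ Visited p → ¬ Top p → Any Top R → Φ p R ≡ 1ℚ
    Φ-bottom-pending {p} {R} ¬vp ¬tp pending with visited? p | top? p
    ... | yes vp | _ = contradiction vp ¬vp
    ... | no _ | yes tp = contradiction tp ¬tp
    ... | no _ | no _ with any? top? R
    ...   | yes _ = refl
    ...   | no ¬pending = contradiction pending ¬pending

    Φ-bottom-settled : ∀ {p R} → ¬ Visited p → ¬ Top p → ¬ Any Top R → Φ p R ≡ 0ℚ
    Φ-bottom-settled {p} {R} ¬vp ¬tp ¬pending with visited? p | top? p
    ... | yes vp | _ = contradiction vp ¬vp
    ... | no _ | yes tp = contradiction tp ¬tp
    ... | no _ | no _ with any? top? R
    ...   | yes pending = contradiction pending ¬pending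
    ...   | no _ = refl

    Φ-visited-dear : ∀ {p R} → Visited p → ¬ Any (Cheap p) R → Φ p R ≡ 0ℚ
    Φ-visited-dear {p} {R} vp ¬c with visited? p | top? p
    ... | no ¬vp | _ = contradiction vp ¬vp
    ... | yes _ | _ with any? top? R | any? (cheap? p) R
    ...   | yes _ | _ = refl
    ...   | no _  | yes c = contradiction c ¬c
    ...   | no _  | no _ = refl

    Φ-≥1-α : ∀ {p R} → 1ℚ - α ≤ Φ p R
    Φ-≥1-α {p} {R} with visited? p | top? p
    ... | yes _ | _ with any? top? R | any? (cheap? p) R
    ...   | yes _ | _     = 1-α≤0
    ...   | no _  | yes _ = ℚ.≤-refl
    ...   | no _  | no _  = 1-α≤0
    Φ-≥1-α {p} {R} | no _ | yes _ with g ∈? R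
    ...   | yes _ = 1-α≤0
    ...   | no _  = ℚ.≤-trans 1-α≤0 (ℚ.nonNegative⁻¹ 1ℚ)
    Φ-≥1-α {p} {R} | no _ | no _ with any? top? R
    ...   | yes _ = ℚ.≤-trans 1-α≤0 (ℚ.nonNegative⁻¹ 1ℚ)
    ...   | no _  = 1-α≤0

    Φ-≤1 : ∀ {p R} → Φ p R ≤ 1ℚ
    Φ-≤1 {p} {R} with visited? p | top? p
    ... | yes _ | _ with any? top? R | any? (cheap? p) R
    ...   | yes _ | _     = ℚ.nonNegative⁻¹ 1ℚ
    ...   | no _  | yes _ = ℚ.≤-trans 1-α≤0 (ℚ.nonNegative⁻¹ 1ℚ)
    ...   | no _  | no _  = ℚ.nonNegative⁻¹ 1ℚ
    Φ-≤1 {p} {R} | no _ | yes _ with g ∈? R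
    ...   | yes _ = ℚ.nonNegative⁻¹ 1ℚ
    ...   | no _  = ℚ.≤-refl
    Φ-≤1 {p} {R} | no _ | no _ with any? top? R
    ...   | yes _ = ℚ.≤-refl
    ...   | no _  = ℚ.nonNegative⁻¹ 1ℚ

    Φ-unvisited-≥0 : ∀ {p R} → ¬ Visited p → 0ℚ ≤ Φ p R
    Φ-unvisited-≥0 {p} {R} ¬vp with visited? p | top? p
    ... | yes vp | _ = contradiction vp ¬vp
    ... | no _ | yes _ with g ∈? R
    ...   | yes _ = ℚ.≤-refl
    ...   | no _  = ℚ.nonNegative⁻¹ 1ℚ
    Φ-unvisited-≥0 {p} {R} ¬vp | no _ | no _ with any? top? R
    ...   | yes _ = ℚ.nonNegative⁻¹ 1ℚ
    ...   | no _  = ℚ.≤-refl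

  Φ-pending-≥0 : ∀ {p R} → Any Top R → 0ℚ ≤ Φ p R
  Φ-pending-≥0 {p} {R} pending with visited? p
  ... | yes vp = ℚ.≤-reflexive (sym (Φ-visited-pending vp pending))
  ... | no ¬vp = Φ-unvisited-≥0 ¬vp

  open PotentialMethod adj t f α (λ x → ¬ Visited x) Φ

  unvisited-step : ∀ {p x R} → ¬ Visited p → ¬ Visited x → adj p x ≡ true → p ∉ R → x ∈ R →
    Φ p R ≤ Φ x (R ∖ x)
  unvisited-step {p} {x} {R} ¬vp ¬vx p~x p∉R x∈R with top? p | top? x
  ... | yes tp | yes tx with g ∈? R
  ...   | yes g∈R = begin
    Φ p R         ≡⟨ Φ-top-open ¬vp tp g∈R ⟩
    0ℚ            ≤⟨ Φ-unvisited-≥0 ¬vx ⟩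
    Φ x (R ∖ x)   ∎
  ...   | no g∉R = begin
    Φ p R         ≡⟨ Φ-top-closed ¬vp tp g∉R ⟩
    1ℚ            ≡⟨ Φ-top-closed ¬vx tx (∉-∖ {x} {R = R} g∉R) ⟨
    Φ x (R ∖ x)   ∎
  unvisited-step {p} {x} {R} ¬vp ¬vx p~x p∉R x∈R | yes tp | no ¬tx = begin
    Φ p R         ≡⟨ Φ-top-open ¬vp tp (subst (_∈ R) (top-exit tp p~x ¬vx ¬tx) x∈R) ⟩
    0ℚ            ≤⟨ Φ-unvisited-≥0 ¬vx ⟩
    Φ x (R ∖ x)   ∎
  unvisited-step {p} {x} {R} ¬vp ¬vx p~x p∉R x∈R | no ¬tp | yes tx = begin
    Φ p R         ≤⟨ Φ-≤1 ⟩
    1ℚ            ≡⟨ Φ-top-closed ¬vx tx (∉-∖ {x} {R = R} g∉R) ⟨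
    Φ x (R ∖ x)   ∎
    where
    g∉R : g ∉ R
    g∉R = subst (_∉ R) (top-exit tx (trans (adj-sym x p) p~x) ¬vp ¬tp) p∉R
  unvisited-step {p} {x} {R} ¬vp ¬vx p~x p∉R x∈R | no ¬tp | no ¬tx with any? top? R
  ... | yes pending = begin
    Φ p R         ≡⟨ Φ-bottom-pending ¬vp ¬tp pending ⟩
    1ℚ            ≡⟨ Φ-bottom-pending ¬vx ¬tx (any-∖⁺ ¬tx pending) ⟨
    Φ x (R ∖ x)   ∎
  ... | no ¬pending = begin
    Φ p R         ≡⟨ Φ-bottom-settled ¬vp ¬tp ¬pending ⟩
    0ℚ            ≡⟨ Φ-bottom-settled ¬vx ¬tx (¬pending ∘ any-∖⁻) ⟨
    Φ x (R ∖ x)   ∎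

  enter-visited : ∀ {p x R} → Visited p → ¬ Visited x → adj p x ≡ true → x ∈ R →
    α + Φ p R ≤ f p x + Φ x (R ∖ x)
  enter-visited {p} {x} {R} vp ¬vx p~x x∈R with top? x | any? top? R
  ... | yes tx | _ = begin
    α + Φ p R            ≡⟨ cong (α +_) (Φ-visited-pending vp (lose x∈R tx)) ⟩
    α + 0ℚ               ≤⟨ ℚ.+-mono-≤ α≤fpx (Φ-unvisited-≥0 ¬vx) ⟩
    f p x + Φ x (R ∖ x)  ∎
    where
    α≤fpx : α ≤ f p x
    α≤fpx = subst (α ≤_) (f-sym x p) (top-sealed tx vp (trans (adj-sym x p) p~x))
  ... | no ¬tx | yes pending = begin
    α + Φ p R            ≡⟨ cong (α +_) (Φ-visited-pending vp pending) ⟩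
    α + 0ℚ               ≡⟨ ℚ.+-identityʳ α ⟩
    α                    ≤⟨ α≤2 ⟩
    1ℚ + 1ℚ              ≤⟨ ℚ.+-monoˡ-≤ 1ℚ (f≥1 p~x) ⟩
    f p x + 1ℚ           ≡⟨ cong (f p x +_) (Φ-bottom-pending ¬vx ¬tx (any-∖⁺ ¬tx pending)) ⟨
    f p x + Φ x (R ∖ x)  ∎
  ... | no ¬tx | no ¬pending with cheap? p x
  ...   | yes c = begin
    α + Φ p R            ≡⟨ cong (α +_) (Φ-visited-cheap vp ¬pending x∈R c) ⟩
    α + (1ℚ - α)         ≡⟨ α+[1-α]≡1 ⟩
    1ℚ                   ≤⟨ ≥1-+-≥0 (f≥1 p~x) (Φ-unvisited-≥0 ¬vx) ⟩
    f p x + Φ x (R ∖ x)  ∎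
  ...   | no ¬c = ℚ.+-mono-≤ (f-dear p~x ¬c) (ℚ.≤-trans (Φ-visited-≤0 vp) (Φ-unvisited-≥0 ¬vx))

  enter : Enter
  enter {p} {x} p~x p∉R newR x∈R with visited? p
  ... | yes vp = enter-visited vp (All.lookup newR x∈R) p~x x∈R
  ... | no ¬vp = ℚ.+-mono-≤ (f-unvisited p~x ¬vp ¬vx) (unvisited-step ¬vp ¬vx p~x p∉R x∈R)
    where
    ¬vx : ¬ Visited x
    ¬vx = All.lookup newR x∈R

  pass : Pass
  pass {p} {x} {R} p~x p∉R newR x∉R with visited? p
  ... | yes vp = ℚ.≤-trans (Φ-visited-≤0 vp) (≥1-+-≥1-α (f≥1 p~x) Φ-≥1-α)
  ... | no ¬vp with visited? x | any? top? R
  ...   | no ¬vx | _ = ℚ.≤-trans Φ-≤1 (≥1-+-≥0 (f≥1 p~x) (Φ-unvisited-≥0 ¬vx))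
  ...   | yes _ | yes pending = ℚ.≤-trans Φ-≤1 (≥1-+-≥0 (f≥1 p~x) (Φ-pending-≥0 pending))
  ...   | yes vx | no ¬pending with top? p
  ...     | yes tp = ℚ.≤-trans Φ-≤1 (≥α-+-≥1-α (top-sealed tp vx p~x) Φ-≥1-α)
  ...     | no ¬tp = begin
    Φ p R        ≡⟨ Φ-bottom-settled ¬vp ¬tp ¬pending ⟩
    0ℚ           ≤⟨ ≥1-+-≥1-α (f≥1 p~x) Φ-≥1-α ⟩
    f p x + Φ x R ∎

  final : Φ t [] ≤ 0ℚ
  final with visited? t
  ... | yes vt = Φ-visited-≤0 vt
  ... | no ¬vt = ℚ.≤-reflexive (Φ-bottom-settled ¬vt t-not-top λ ())

  gate-bound : WalkBound
  gate-bound = potential-bound enter pass final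

-- Every edge between Inside and the rest costs α unless it ends at v. Φ charges α - 1 to an
-- outside vertex while inside vertices remain, and to an inside vertex once v has been visited:
-- the walk must still cross the cut towards t, and only the first visit of v is a cheap crossing.
module CutPotential
  {n : ℕ} (adj : Fin n → Fin n → Bool) (adj-sym : ∀ x y → adj x y ≡ adj y x) (t : Fin n)
  (f : Fin n → Fin n → ℚ) (f-sym : ∀ x y → f x y ≡ f y x)
  {α : ℚ} (1≤α : 1ℚ ≤ α) (α≤2 : α ≤ 2ℚ)
  (f≥1 : ∀ {x y} → adj x y ≡ true → 1ℚ ≤ f x y)
  {Inside : Pred (Fin n) 0ℓ} (inside? : Decidable Inside) (v : Fin n)
  (v-outside : ¬ Inside v) (t-outside : ¬ Inside t)
  (crossing-dear : ∀ {x y} → Inside x → ¬ Inside y → y ≢ v → adj x y ≡ true → α ≤ f x y)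
  where

  open Removal (_≟ᶠ_ {n})
  open DecMembership (_≟ᶠ_ {n}) using (_∈?_)
  open ℚ.≤-Reasoning

  0≤α-1 : 0ℚ ≤ α - 1ℚ
  0≤α-1 = begin
    0ℚ      ≡⟨ ℚ.+-inverseʳ 1ℚ ⟨
    1ℚ - 1ℚ ≤⟨ ℚ.+-monoˡ-≤ (- 1ℚ) 1≤α ⟩
    α - 1ℚ  ∎

  α-1≤1 : α - 1ℚ ≤ 1ℚ
  α-1≤1 = begin
    α - 1ℚ   ≤⟨ ℚ.+-monoˡ-≤ (- 1ℚ) α≤2 ⟩
    2ℚ - 1ℚ  ≡⟨⟩
    1ℚ       ∎

  1+[α-1]≡α : 1ℚ + (α - 1ℚ) ≡ α
  1+[α-1]≡α = solve 1 (λ a → con 1ℚ :+ (a :- con 1ℚ) := a) refl α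
    where open +-*-Solver

  opaque
    Φ : Fin n → List (Fin n) → ℚ
    Φ p R with inside? p
    ... | yes _ = if does (v ∈? R) then 0ℚ else α - 1ℚ
    ... | no _  = if does (any? inside? R) then α - 1ℚ else 0ℚ

    Φ-inside-open : ∀ {p R} → Inside p → v ∈ R → Φ p R ≡ 0ℚ
    Φ-inside-open {p} {R} ip v∈R with inside? p
    ... | no ¬ip = contradiction ip ¬ip
    ... | yes _ with v ∈? R
    ...   | yes _ = refl
    ...   | no v∉R = contradiction v∈R v∉R

    Φ-inside-closed : ∀ {p R} → Inside p → v ∉ R → Φ p R ≡ α - 1ℚ
    Φ-inside-closed {p} {R} ip v∉R with inside? p
    ... | no ¬ip = contradiction ip ¬ip
    ... | yes _ with v ∈? R
    ...   | yes v∈R = contradiction v∈R v∉R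
    ...   | no _ = refl

    Φ-outside-pending : ∀ {p R} → ¬ Inside p → Any Inside R → Φ p R ≡ α - 1ℚ
    Φ-outside-pending {p} {R} ¬ip pending with inside? p
    ... | yes ip = contradiction ip ¬ip
    ... | no _ with any? inside? R
    ...   | yes _ = refl
    ...   | no ¬pending = contradiction pending ¬pending

    Φ-outside-settled : ∀ {p R} → ¬ Inside p → ¬ Any Inside R → Φ p R ≡ 0ℚ
    Φ-outside-settled {p} {R} ¬ip ¬pending with inside? p
    ... | yes ip = contradiction ip ¬ip
    ... | no _ with any? inside? R
    ...   | yes pending = contradiction pending ¬pending
    ...   | no _ = refl

    Φ-≥0 : ∀ {p R} → 0ℚ ≤ Φ p R
    Φ-≥0 {p} {R} with inside? p
    ... | yes _ with v ∈? R
    ...   | yes _ = ℚ.≤-refl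
    ...   | no _  = 0≤α-1
    Φ-≥0 {p} {R} | no _ with any? inside? R
    ...   | yes _ = 0≤α-1
    ...   | no _  = ℚ.≤-refl

    Φ-≤α-1 : ∀ {p R} → Φ p R ≤ α - 1ℚ
    Φ-≤α-1 {p} {R} with inside? p
    ... | yes _ with v ∈? R
    ...   | yes _ = 0≤α-1
    ...   | no _  = ℚ.≤-refl
    Φ-≤α-1 {p} {R} | no _ with any? inside? R
    ...   | yes _ = ℚ.≤-refl
    ...   | no _  = 0≤α-1

  open PotentialMethod adj t f 1ℚ (λ _ → ⊤) Φ

  crossing-step : ∀ {p x R} → α ≤ f p x → 1ℚ + Φ p R ≤ f p x + Φ x (R ∖ x)
  crossing-step {p} {x} {R} α≤f = begin
    1ℚ + Φ p R          ≤⟨ ℚ.+-monoʳ-≤ 1ℚ Φ-≤α-1 ⟩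
    1ℚ + (α - 1ℚ)       ≡⟨ 1+[α-1]≡α ⟩
    α                   ≡⟨ ℚ.+-identityʳ α ⟨
    α + 0ℚ              ≤⟨ ℚ.+-mono-≤ α≤f Φ-≥0 ⟩
    f p x + Φ x (R ∖ x) ∎

  enter : Enter
  enter {p} {x} {R} p~x p∉R _ x∈R with inside? p | inside? x
  ... | yes ip | yes ix = ℚ.+-mono-≤ (f≥1 p~x) inside-step
    where
    inside-step : Φ p R ≤ Φ x (R ∖ x)
    inside-step with v ∈? R
    ... | yes v∈R = ℚ.≤-trans (ℚ.≤-reflexive (Φ-inside-open ip v∈R)) Φ-≥0
    ... | no v∉R =
      ℚ.≤-reflexive (trans (Φ-inside-closed ip v∉R) (sym (Φ-inside-closed ix (∉-∖ {x} {R = R} v∉R))))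
  ... | yes ip | no ¬ix with x ≟ᶠ v
  ...   | yes refl = begin
    1ℚ + Φ p R          ≡⟨ cong (1ℚ +_) (Φ-inside-open ip x∈R) ⟩
    1ℚ + 0ℚ             ≤⟨ ℚ.+-mono-≤ (f≥1 p~x) Φ-≥0 ⟩
    f p x + Φ x (R ∖ x) ∎
  ...   | no x≢v = crossing-step (crossing-dear ip ¬ix x≢v p~x)
  enter {p} {x} {R} p~x p∉R _ x∈R | no ¬ip | yes ix with p ≟ᶠ v
  ... | yes refl = begin
    1ℚ + Φ p R          ≡⟨ cong (1ℚ +_) (Φ-outside-pending ¬ip (lose x∈R ix)) ⟩
    1ℚ + (α - 1ℚ)       ≡⟨ cong (1ℚ +_) (Φ-inside-closed ix (∉-∖ {x} {R = R} p∉R)) ⟨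
    1ℚ + Φ x (R ∖ x)    ≤⟨ ℚ.+-monoˡ-≤ (Φ x (R ∖ x)) (f≥1 p~x) ⟩
    f p x + Φ x (R ∖ x) ∎
  ... | no p≢v = crossing-step (subst (α ≤_) (f-sym x p) (crossing-dear ix ¬ip p≢v (trans (adj-sym x p) p~x)))
  enter {p} {x} {R} p~x p∉R _ x∈R | no ¬ip | no ¬ix = ℚ.+-mono-≤ (f≥1 p~x) (ℚ.≤-reflexive outside-step)
    where
    outside-step : Φ p R ≡ Φ x (R ∖ x)
    outside-step with any? inside? R
    ... | yes pending = trans (Φ-outside-pending ¬ip pending) (sym (Φ-outside-pending ¬ix (any-∖⁺ ¬ix pending)))
    ... | no ¬pending = trans (Φ-outside-settled ¬ip ¬pending) (sym (Φ-outside-settled ¬ix (¬pending ∘ any-∖⁻)))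

  pass : Pass
  pass {p} {x} {R} p~x _ _ _ = begin
    Φ p R       ≤⟨ Φ-≤α-1 ⟩
    α - 1ℚ      ≤⟨ α-1≤1 ⟩
    1ℚ          ≡⟨ ℚ.+-identityʳ 1ℚ ⟨
    1ℚ + 0ℚ     ≤⟨ ℚ.+-mono-≤ (f≥1 p~x) Φ-≥0 ⟩
    f p x + Φ x R ∎

  cut-bound : WalkBound
  cut-bound = potential-bound enter pass (ℚ.≤-reflexive (Φ-outside-settled t-outside λ ()))

-- Instances announced with [1, α]

module AnnouncedInstance (I : Instance) {α : ℚ} (1≤α : 1ℚ ≤ α) (announced : Announced I α) where

  open Instance I
  open Removal (_≟ᶠ_ {n})
  open ℚ.≤-Reasoning

  est-sym : ∀ vis x y → est I vis x y ≡ est I vis y x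
  est-sym vis x y
    rewrite ∨-comm (does (mem? _≟ᶠ_ x vis)) (does (mem? _≟ᶠ_ y vis)) | w-sym x y | up-sym x y = refl

  est-revealed : ∀ {vis x} y → x ∈ vis → est I vis x y ≡ w x y
  est-revealed {vis} {x} y x∈vis with mem? _≟ᶠ_ x vis
  ... | yes _ = refl
  ... | no x∉vis = contradiction x∈vis x∉vis

  est-unrevealed : ∀ {vis x y} → adj x y ≡ true → x ∉ vis → y ∉ vis → est I vis x y ≡ α
  est-unrevealed {vis} {x} {y} x~y x∉vis y∉vis with mem? _≟ᶠ_ x vis | mem? _≟ᶠ_ y vis
  ... | yes x∈vis | _ = contradiction x∈vis x∉vis
  ... | no _ | yes y∈vis = contradiction y∈vis y∉vis
  ... | no _ | no _ = proj₂ (announced x y x~y)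

  est-≥1 : ∀ {vis x y} → adj x y ≡ true → 1ℚ ≤ est I vis x y
  est-≥1 {vis} {x} {y} x~y with does (mem? _≟ᶠ_ x vis) ∨ does (mem? _≟ᶠ_ y vis)
  ... | true = subst (_≤ w x y) (proj₁ (announced x y x~y)) (w-lo x y x~y)
  ... | false = subst (1ℚ ≤_) (sym (proj₂ (announced x y x~y))) 1≤α

  cost-≥0 : ∀ {vis u} xs → Steps adj u xs → 0ℚ ≤ cost (est I vis) u xs
  cost-≥0 [] _ = ℚ.≤-refl
  cost-≥0 {vis} {u} (x ∷ xs) (u~x , steps) = begin
    0ℚ                                   ≤⟨ ℚ.nonNegative⁻¹ 1ℚ ⟩
    1ℚ + 0ℚ                              ≤⟨ ℚ.+-mono-≤ (est-≥1 {vis} u~x) (cost-≥0 {vis} xs steps) ⟩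
    est I vis u x + cost (est I vis) x xs ∎

  cost-unrevealed : ∀ {vis u} xs → Steps adj u xs → u ∉ vis → All (_∉ vis) xs →
    cost (est I vis) u xs ≡ length xs · α
  cost-unrevealed [] _ _ _ = refl
  cost-unrevealed (x ∷ xs) (u~x , steps) u∉vis (x∉vis ∷ xs∉vis) =
    cong₂ _+_ (est-unrevealed u~x u∉vis x∉vis) (cost-unrevealed xs steps x∉vis xs∉vis)

  move-excluded : ∀ {vis u v plan} → Move I vis u v → Feasible I vis u plan →
    (∀ {ys} → Feasible I vis u (v ∷ ys) → cost (est I vis) u plan < cost (est I vis) u (v ∷ ys)) → ⊥
  move-excluded (_ , feasible , optimal) plan-feasible cheaper =
    ℚ.<-irrefl refl (ℚ.<-≤-trans (cheaper feasible) (optimal _ plan-feasible))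

  no-move-at-end : ∀ {vis v} → (∀ x → x ∈ vis) → ¬ Move I vis t v
  no-move-at-end {vis} {v} all-visited (xs , ((t~v , steps) , _ , _) , optimal) =
    ℚ.<-irrefl refl (ℚ.<-≤-trans walk-positive (optimal [] stay))
    where
    stay : Feasible I vis t []
    stay = tt , refl , λ y y∉vis → contradiction (all-visited y) y∉vis
    walk-positive : 0ℚ < cost (est I vis) t (v ∷ xs)
    walk-positive = begin-strict
      0ℚ                                    <⟨ ℚ.positive⁻¹ 1ℚ ⟩
      1ℚ + 0ℚ                               ≤⟨ ℚ.+-mono-≤ (est-≥1 {vis} t~v) (cost-≥0 {vis} xs steps) ⟩
      est I vis t v + cost (est I vis) v xs ∎

  run-walk : ∀ {vis u ms} → Run I vis u ms → Steps adj u ms × endAt u ms ≡ t × (∀ x → x ∈ vis ⊎ x ∈ ms)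
  run-walk (done u≡t all-visited) = tt , u≡t , inj₁ ∘ all-visited
  run-walk {vis} {ms = v ∷ ms} (step (_ , ((u~v , _) , _) , _) run) with run-walk run
  ... | steps , end , seen = (u~v , steps) , end , λ x → shift x (seen x)
    where
    shift : ∀ x → x ∈ v ∷ vis ⊎ x ∈ ms → x ∈ vis ⊎ x ∈ v ∷ ms
    shift x (inj₁ (here x≡v)) = inj₂ (here x≡v)
    shift x (inj₁ (there x∈vis)) = inj₁ x∈vis
    shift x (inj₂ x∈ms) = inj₂ (there x∈ms)

  alg-run-tour : ∀ {ms} → AlgRun I ms → Tour I ms
  alg-run-tour {ms} run with run-walk run
  ... | steps , end , seen = steps , end , λ x → start-or-later x (seen x)
    where
    start-or-later : ∀ x → x ∈ s ∷ [] ⊎ x ∈ ms → x ∈ s ∷ ms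
    start-or-later x (inj₁ (here x≡s)) = here x≡s
    start-or-later x (inj₂ x∈ms) = there x∈ms

  module _ {vis : List V} {Φ : V → List V → ℚ}
    (bound : PotentialMethod.WalkBound adj t (est I vis) α (_∉ vis) Φ)
    {u : V} {R : List V} (u∈vis : u ∈ vis) (uR : Unique R) (R-new : All (_∉ vis) R) where

    private
      covered : ∀ {ys y} → (∀ v → ¬ v ∈ vis → v ∈ u ∷ ys) → y ∈ R → y ∈ ys
      covered {ys} {y} cover y∈R with cover y (All.lookup R-new y∈R)
      ... | here refl = contradiction u∈vis (All.lookup R-new y∈R)
      ... | there y∈ys = y∈ys

    feasible-bound : ∀ {ys} → Feasible I vis u ys → length R · α + Φ u R ≤ cost (est I vis) u ys
    feasible-bound {ys} (steps , end , cover) =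
      bound ys steps end (covered cover) uR (λ u∈R → All.lookup R-new u∈R u∈vis) R-new

    detour-visited : ∀ {v ys} → Feasible I vis u (v ∷ ys) → v ∈ vis →
      est I vis u v + (length R · α + Φ v R) ≤ cost (est I vis) u (v ∷ ys)
    detour-visited {v} {ys} ((_ , steps) , end , cover) v∈vis =
      ℚ.+-monoʳ-≤ (est I vis u v) (bound ys steps end R⊆ys uR (λ v∈R → All.lookup R-new v∈R v∈vis) R-new)
      where
      R⊆ys : R ⊆ ys
      R⊆ys y∈R with covered cover y∈R
      ... | here refl = contradiction v∈vis (All.lookup R-new y∈R)
      ... | there y∈ys = y∈ys

    detour-unvisited : ∀ {v ys} → Feasible I vis u (v ∷ ys) →
      est I vis u v + (length (R ∖ v) · α + Φ v (R ∖ v)) ≤ cost (est I vis) u (v ∷ ys)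
    detour-unvisited {v} {ys} ((_ , steps) , end , cover) =
      ℚ.+-monoʳ-≤ (est I vis u v)
        (bound ys steps end R∖v⊆ys (unique-∖ uR) (λ v∈R∖v → proj₂ (∈-∖⁻ {v} {R = R} v∈R∖v) refl)
               (all-∖ R-new))
      where
      R∖v⊆ys : R ∖ v ⊆ ys
      R∖v⊆ys {y} y∈R∖v with ∈-∖⁻ {v} {y} {R} y∈R∖v
      ... | y∈R , y≢v with covered cover y∈R
      ...   | here y≡v = contradiction y≡v y≢v
      ...   | there y∈ys = y∈ys

-- The ladder

-- Vertices are numbered by the step at which the algorithm reaches them: s = 0, e_j = j
-- (1 ≤ j ≤ k), d_j = N - j (1 ≤ j < k) and t = N. Rungs e_j–d_j are the pairs summing to N,
-- diagonals e_{j+1}–d_j and e₁–t the pairs summing to N + 1, and the chord is s–e_k.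
module LadderGraph (m : ℕ) where

  k : ℕ
  k = suc (suc m)

  N : ℕ
  N = k ℕ.+ k

  data Cheap : ℕ → ℕ → Set where
    start : Cheap 0 1
    rung  : ∀ {a b} → 1 ℕ.≤ a → a ℕ.< k → a ℕ.+ b ≡ N → Cheap a b
    brace : ∀ {a b} → 1 ℕ.≤ a → a ℕ.≤ k → a ℕ.+ b ≡ suc N → Cheap a b

  data Link : ℕ → ℕ → Set where
    cheap : ∀ {a b} → Cheap a b → Link a b
    step  : ∀ {a} → Link a (suc a)
    chord : Link 0 k

  private
    CheapCases : ℕ → ℕ → Set
    CheapCases a b =
      (a ≡ 0 × b ≡ 1) ⊎ (1 ℕ.≤ a × a ℕ.< k × a ℕ.+ b ≡ N) ⊎ (1 ℕ.≤ a × a ℕ.≤ k × a ℕ.+ b ≡ suc N)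

    from-cases : ∀ {a b} → CheapCases a b → Cheap a b
    from-cases (inj₁ (refl , refl)) = start
    from-cases (inj₂ (inj₁ (1≤a , a<k , sum))) = rung 1≤a a<k sum
    from-cases (inj₂ (inj₂ (1≤a , a≤k , sum))) = brace 1≤a a≤k sum

    to-cases : ∀ {a b} → Cheap a b → CheapCases a b
    to-cases start = inj₁ (refl , refl)
    to-cases (rung 1≤a a<k sum) = inj₂ (inj₁ (1≤a , a<k , sum))
    to-cases (brace 1≤a a≤k sum) = inj₂ (inj₂ (1≤a , a≤k , sum))

    LinkCases : ℕ → ℕ → Set
    LinkCases a b = Cheap a b ⊎ b ≡ suc a ⊎ (a ≡ 0 × b ≡ k)

    from-link-cases : ∀ {a b} → LinkCases a b → Link a b
    from-link-cases (inj₁ c) = cheap c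
    from-link-cases (inj₂ (inj₁ refl)) = step
    from-link-cases (inj₂ (inj₂ (refl , refl))) = chord

    to-link-cases : ∀ {a b} → Link a b → LinkCases a b
    to-link-cases (cheap c) = inj₁ c
    to-link-cases step = inj₂ (inj₁ refl)
    to-link-cases chord = inj₂ (inj₂ (refl , refl))

  cheap? : ∀ a b → Dec (Cheap a b)
  cheap? a b = map′ from-cases to-cases
    ((a ℕ.≟ 0 ×-dec b ℕ.≟ 1) ⊎-dec (1 ℕ.≤? a ×-dec a ℕ.<? k ×-dec a ℕ.+ b ℕ.≟ N)
                             ⊎-dec (1 ℕ.≤? a ×-dec a ℕ.≤? k ×-dec a ℕ.+ b ℕ.≟ suc N))

  link? : ∀ a b → Dec (Link a b)
  link? a b = map′ from-link-cases to-link-cases (cheap? a b ⊎-dec b ℕ.≟ suc a ⊎-dec (a ℕ.≟ 0 ×-dec b ℕ.≟ k))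

  private
    double-injective : ∀ {m n} → m ℕ.+ m ≡ n ℕ.+ n → m ≡ n
    double-injective {m} {n} eq = trans (ℕ.n≡⌊n+n/2⌋ m) (trans (cong ⌊_/2⌋ eq) (sym (ℕ.n≡⌊n+n/2⌋ n)))

    odd≢even : ∀ {m n} → suc (m ℕ.+ m) ≢ n ℕ.+ n
    odd≢even {m} {n} eq = ℕ.1+n≢n (trans (cong (λ l → suc (l ℕ.+ l)) (sym m≡n)) eq)
      where
      m≡n : m ≡ n
      m≡n = trans (ℕ.n≡⌈n+n/2⌉ m) (trans (cong ⌊_/2⌋ eq) (sym (ℕ.n≡⌊n+n/2⌋ n)))

    sum-below : ∀ {i x y n} → i ℕ.< x → x ℕ.+ y ≡ n → y ℕ.+ i ℕ.< n
    sum-below {i} {x} {y} i<x refl = subst (y ℕ.+ i ℕ.<_) (ℕ.+-comm y x) (ℕ.+-monoʳ-< y i<x)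

    sum-squeeze : ∀ {i x y} → i ℕ.< x → x ℕ.+ y ≡ suc N → N ℕ.≤ y ℕ.+ i → y ℕ.+ i ≡ N
    sum-squeeze i<x sum N≤ = ℕ.≤-antisym (ℕ.≤-pred (sum-below i<x sum)) N≤

  cheap-< : ∀ {a b} → Cheap a b → a ℕ.< b
  cheap-< start = ℕ.z<s
  cheap-< (rung {a} {b} _ a<k sum) =
    ℕ.≰⇒> λ b≤a → ℕ.<-irrefl sum (ℕ.≤-<-trans (ℕ.+-monoʳ-≤ a b≤a) (ℕ.+-mono-< a<k a<k))
  cheap-< (brace {a} {b} _ a≤k sum) =
    ℕ.≰⇒> λ b≤a → ℕ.<-irrefl sum (s≤s (ℕ.≤-trans (ℕ.+-monoʳ-≤ a b≤a) (ℕ.+-mono-≤ a≤k a≤k)))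

  link-< : ∀ {a b} → Link a b → a ℕ.< b
  link-< (cheap c) = cheap-< c
  link-< step = ℕ.n<1+n _
  link-< chord = ℕ.z<s

  cheap-step : ∀ {i} → Cheap i (suc i) → i ≡ 0 ⊎ i ≡ k
  cheap-step start = inj₁ refl
  cheap-step (rung {i} _ _ sum) = contradiction (trans (sym (ℕ.+-suc i i)) sum) (odd≢even {i} {k})
  cheap-step (brace {i} _ _ sum) = inj₂ (double-injective {i} {k} (ℕ.suc-injective (trans (sym (ℕ.+-suc i i)) sum)))

  turn-cheap : Cheap k (suc k)
  turn-cheap = brace (s≤s z≤n) ℕ.≤-refl (ℕ.+-suc k k)

  cheap-beyond-turn : ∀ {i y} → k ℕ.< i → ¬ Cheap i y
  cheap-beyond-turn () start
  cheap-beyond-turn k<i (rung _ i<k _) = ℕ.<-asym k<i i<k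
  cheap-beyond-turn k<i (brace _ i≤k _) = ℕ.<⇒≱ k<i i≤k

  chord-dear : ¬ Cheap 0 k
  chord-dear (rung () _ _)
  chord-dear (brace () _ _)

  forward-link : ∀ {i y} → Link i y →
    y ≡ suc i ⊎ (i ≡ 0 × y ≡ k) ⊎ (1 ℕ.≤ i × i ℕ.< k × N ℕ.≤ y ℕ.+ i)
  forward-link (cheap start) = inj₁ refl
  forward-link (cheap (rung {i} {y} 1≤i i<k sum)) =
    inj₂ (inj₂ (1≤i , i<k , ℕ.≤-reflexive (sym (trans (ℕ.+-comm y i) sum))))
  forward-link (cheap (brace {i} {y} 1≤i i≤k sum)) with ℕ.m≤n⇒m<n∨m≡n i≤k
  ... | inj₁ i<k =
    inj₂ (inj₂ (1≤i , i<k , ℕ.≤-trans (ℕ.n≤1+n N) (ℕ.≤-reflexive (sym (trans (ℕ.+-comm y i) sum)))))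
  ... | inj₂ refl = inj₁ (ℕ.+-cancelˡ-≡ k y (suc k) (trans sum (sym (ℕ.+-suc k k))))
  forward-link step = inj₁ refl
  forward-link chord = inj₂ (inj₁ (refl , refl))

  top-exit : ∀ {i x y} → i ℕ.< x → x ℕ.+ i ℕ.< N → i ℕ.< y → N ℕ.≤ y ℕ.+ i → Link x y ⊎ Link y x →
    y ℕ.+ i ≡ N
  top-exit () _ _ _ (inj₁ (cheap start))
  top-exit i<x _ _ N≤ (inj₁ (cheap (rung _ _ sum))) = contradiction N≤ (ℕ.<⇒≱ (sum-below i<x sum))
  top-exit i<x _ _ N≤ (inj₁ (cheap (brace _ _ sum))) = sum-squeeze i<x sum N≤
  top-exit _ x+i<N _ N≤ (inj₁ step) = ℕ.≤-antisym x+i<N N≤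
  top-exit () _ _ _ (inj₁ chord)
  top-exit _ _ () _ (inj₂ (cheap start))
  top-exit {x = x} {y} i<x _ _ N≤ (inj₂ (cheap (rung _ _ sum))) =
    contradiction N≤ (ℕ.<⇒≱ (sum-below i<x (trans (ℕ.+-comm x y) sum)))
  top-exit {x = x} {y} i<x _ _ N≤ (inj₂ (cheap (brace _ _ sum))) = sum-squeeze i<x (trans (ℕ.+-comm x y) sum) N≤
  top-exit _ x+i<N _ N≤ (inj₂ step) = contradiction N≤ (ℕ.<⇒≱ (ℕ.<-trans (ℕ.n<1+n _) x+i<N))
  top-exit _ _ () _ (inj₂ chord)

  top-sealed : ∀ {i x y} → 1 ℕ.≤ i → i ℕ.< x → x ℕ.+ i ℕ.< N → y ℕ.≤ i → ¬ (Cheap x y ⊎ Cheap y x)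
  top-sealed {i} {x} {y} 1≤i i<x x+i<N y≤i = λ where
      (inj₁ start) → contradiction i<x λ ()
      (inj₁ (rung _ _ sum)) → ℕ.<-irrefl sum x+y<N
      (inj₁ (brace _ _ sum)) → ℕ.<-irrefl sum (ℕ.m<n⇒m<1+n x+y<N)
      (inj₂ start) → ℕ.<⇒≱ i<x 1≤i
      (inj₂ (rung _ _ sum)) → ℕ.<-irrefl (trans (ℕ.+-comm x y) sum) x+y<N
      (inj₂ (brace _ _ sum)) → ℕ.<-irrefl (trans (ℕ.+-comm x y) sum) (ℕ.m<n⇒m<1+n x+y<N)
    where
    x+y<N : x ℕ.+ y ℕ.< N
    x+y<N = ℕ.≤-<-trans (ℕ.+-monoʳ-≤ x y≤i) x+i<N

  Interior : ℕ → Set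
  Interior a = 1 ℕ.< a × a ℕ.< N

  cheap-interior : ∀ {a b} → Cheap a b → a ≢ 1 → b ≢ 1 → Interior a × Interior b
  cheap-interior start _ b≢1 = contradiction refl b≢1
  cheap-interior c@(rung {a} {b} 1≤a a<k sum) a≢1 _ =
    (1<a , ℕ.<-≤-trans a<k (ℕ.m≤m+n k k)) , (ℕ.<-trans 1<a (cheap-< c) , subst (b ℕ.<_) sum (ℕ.m<n+m b 1≤a))
    where
    1<a : 1 ℕ.< a
    1<a = ℕ.≤∧≢⇒< 1≤a (a≢1 ∘ sym)
  cheap-interior c@(brace {a} {b} 1≤a a≤k sum) a≢1 _ =
    (1<a , ℕ.≤-<-trans a≤k (ℕ.m<m+n k ℕ.z<s)) ,
    (ℕ.<-trans 1<a (cheap-< c) , ℕ.≤-pred (subst (suc (suc b) ℕ.≤_) sum (ℕ.+-monoˡ-≤ b 1<a)))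
    where
    1<a : 1 ℕ.< a
    1<a = ℕ.≤∧≢⇒< 1≤a (a≢1 ∘ sym)

  zig-brace : ∀ {j} → j ℕ.< k → Cheap (suc j) (N ℕ.∸ j)
  zig-brace {j} j<k = brace (s≤s z≤n) j<k (cong suc (ℕ.m+[n∸m]≡n (ℕ.≤-trans (ℕ.<⇒≤ j<k) (ℕ.m≤m+n k k))))

  zig-rung : ∀ {j} → suc j ℕ.< k → Cheap (suc j) (N ℕ.∸ suc j)
  zig-rung {j} sj<k = rung (s≤s z≤n) sj<k (ℕ.m+[n∸m]≡n (ℕ.≤-trans (ℕ.<⇒≤ sj<k) (ℕ.m≤m+n k k)))

  V : Set
  V = Fin (suc N)

  pos : ℕ → V
  pos j = fromℕ< (s≤s (ℕ.m⊓n≤n j N))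

  toℕ-pos : ∀ {j} → j ℕ.≤ N → toℕ (pos j) ≡ j
  toℕ-pos {j} j≤N = trans (toℕ-fromℕ< _) (ℕ.m≤n⇒m⊓n≡m j≤N)

  pos-toℕ : ∀ x → pos (toℕ x) ≡ x
  pos-toℕ x = toℕ-injective (toℕ-pos (toℕ≤pred[n] x))

  Adjacent : V → V → Set
  Adjacent x y = Link (toℕ x) (toℕ y) ⊎ Link (toℕ y) (toℕ x)

  CheapEdge : V → V → Set
  CheapEdge x y = Cheap (toℕ x) (toℕ y) ⊎ Cheap (toℕ y) (toℕ x)

  adjacent? : ∀ x y → Dec (Adjacent x y)
  adjacent? x y = link? (toℕ x) (toℕ y) ⊎-dec link? (toℕ y) (toℕ x)

  cheapEdge? : ∀ x y → Dec (CheapEdge x y)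
  cheapEdge? x y = cheap? (toℕ x) (toℕ y) ⊎-dec cheap? (toℕ y) (toℕ x)

  adj : V → V → Bool
  adj x y = does (adjacent? x y)

  adj-sym : ∀ x y → adj x y ≡ adj y x
  adj-sym x y = ∨-comm (does (link? (toℕ x) (toℕ y))) (does (link? (toℕ y) (toℕ x)))

  adj-irr : ∀ x → adj x x ≡ false
  adj-irr x = dec-false (adjacent? x x) λ where
    (inj₁ loop) → ℕ.<-irrefl refl (link-< loop)
    (inj₂ loop) → ℕ.<-irrefl refl (link-< loop)

  adjacent : ∀ {x y} → adj x y ≡ true → Adjacent x y
  adjacent {x} {y} x~y = subst (if_then Adjacent x y else ¬ Adjacent x y) x~y (invert (proof (adjacent? x y)))

  step-adj : ∀ {j} → suc j ℕ.≤ N → adj (pos j) (pos (suc j)) ≡ true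
  step-adj {j} sj≤N = dec-true (adjacent? (pos j) (pos (suc j)))
    (inj₁ (subst₂ Link (sym (toℕ-pos (ℕ.<⇒≤ sj≤N))) (sym (toℕ-pos sj≤N)) step))

  cheap-edge : ∀ {a b} → a ℕ.≤ N → b ℕ.≤ N → Cheap a b → CheapEdge (pos a) (pos b) × CheapEdge (pos b) (pos a)
  cheap-edge {a} {b} a≤N b≤N c = inj₁ c′ , inj₂ c′
    where
    c′ : Cheap (toℕ (pos a)) (toℕ (pos b))
    c′ = subst₂ Cheap (sym (toℕ-pos a≤N)) (sym (toℕ-pos b≤N)) c

  private
    cheap-adj : ∀ {a b} → a ℕ.≤ N → b ℕ.≤ N → Cheap a b →
      adj (pos a) (pos b) ≡ true × adj (pos b) (pos a) ≡ true
    cheap-adj {a} {b} a≤N b≤N c =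
      dec-true (adjacent? (pos a) (pos b)) (inj₁ link) , dec-true (adjacent? (pos b) (pos a)) (inj₂ link)
      where
      link : Link (toℕ (pos a)) (toℕ (pos b))
      link = subst₂ Link (sym (toℕ-pos a≤N)) (sym (toℕ-pos b≤N)) (cheap c)

  step-cheap : ∀ {i} → i ℕ.< N → i ≡ 0 ⊎ i ≡ k → CheapEdge (pos i) (pos (suc i))
  step-cheap {i} i<N i≡0∨k rewrite toℕ-pos (ℕ.<⇒≤ i<N) | toℕ-pos i<N with i≡0∨k
  ... | inj₁ refl = inj₁ start
  ... | inj₂ refl = inj₁ turn-cheap

  step-cheap⁻ : ∀ {i} → i ℕ.< N → CheapEdge (pos i) (pos (suc i)) → i ≡ 0 ⊎ i ≡ k
  step-cheap⁻ {i} i<N rewrite toℕ-pos (ℕ.<⇒≤ i<N) | toℕ-pos i<N = λ where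
    (inj₁ c) → cheap-step c
    (inj₂ c) → contradiction (cheap-< c) (ℕ.<-asym (ℕ.n<1+n i))

  forward-neighbour : ∀ {i v} → i ℕ.≤ N → adj (pos i) v ≡ true → i ℕ.< toℕ v →
    toℕ v ≡ suc i ⊎ (i ≡ 0 × toℕ v ≡ k) ⊎ (1 ℕ.≤ i × i ℕ.< k × N ℕ.≤ toℕ v ℕ.+ i)
  forward-neighbour {i} {v} i≤N i~v i<v with adjacent i~v
  ... | inj₁ link = forward-link (subst (λ a → Link a (toℕ v)) (toℕ-pos i≤N) link)
  ... | inj₂ link = contradiction (subst (toℕ v ℕ.<_) (toℕ-pos i≤N) (link-< link)) (ℕ.<-asym i<v)

  chord-not-cheap : ∀ {x y} → toℕ x ≡ 0 → toℕ y ≡ k → ¬ CheapEdge x y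
  chord-not-cheap {x} {y} x≡0 y≡k rewrite x≡0 | y≡k = λ where
    (inj₁ c) → chord-dear c
    (inj₂ c) → contradiction (cheap-< c) λ ()

  no-cheap-beyond-turn : ∀ {i y} → k ℕ.< i → i ℕ.≤ N → i ℕ.< toℕ y → ¬ CheapEdge (pos i) y
  no-cheap-beyond-turn {i} {y} k<i i≤N i<y rewrite toℕ-pos i≤N = λ where
    (inj₁ c) → cheap-beyond-turn k<i c
    (inj₂ c) → ℕ.<-asym i<y (cheap-< c)

  ascent : ℕ → ℕ → List V
  ascent i zero = []
  ascent i (suc r) = pos (suc i) ∷ ascent (suc i) r

  descent : ℕ → List V
  descent zero = []
  descent (suc j) = pos j ∷ descent j

  ascent-steps : ∀ i r → i ℕ.+ r ℕ.≤ N → Steps adj (pos i) (ascent i r)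
  ascent-steps i zero _ = tt
  ascent-steps i (suc r) i+r≤N =
    step-adj (ℕ.≤-trans (ℕ.m≤m+n (suc i) r) (subst (ℕ._≤ N) (ℕ.+-suc i r) i+r≤N)) ,
    ascent-steps (suc i) r (subst (ℕ._≤ N) (ℕ.+-suc i r) i+r≤N)

  ascent-end : ∀ i r → endAt (pos i) (ascent i r) ≡ pos (i ℕ.+ r)
  ascent-end i zero = cong pos (sym (ℕ.+-identityʳ i))
  ascent-end i (suc r) = trans (ascent-end (suc i) r) (cong pos (sym (ℕ.+-suc i r)))

  ascent-++ : ∀ i a b → ascent i (a ℕ.+ b) ≡ ascent i a ++ ascent (i ℕ.+ a) b
  ascent-++ i zero b = cong (λ j → ascent j b) (sym (ℕ.+-identityʳ i))
  ascent-++ i (suc a) b = cong (pos (suc i) ∷_)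
    (trans (ascent-++ (suc i) a b) (cong (λ j → ascent (suc i) a ++ ascent j b) (sym (ℕ.+-suc i a))))

  descent-steps : ∀ j → j ℕ.≤ N → Steps adj (pos j) (descent j)
  descent-steps zero _ = tt
  descent-steps (suc j) sj≤N = trans (adj-sym (pos (suc j)) (pos j)) (step-adj sj≤N) , descent-steps j (ℕ.<⇒≤ sj≤N)

  descent-end : ∀ j → endAt (pos j) (descent j) ≡ pos 0
  descent-end zero = refl
  descent-end (suc j) = descent-end j

  ∈-ascent⁻ : ∀ {i r y} → i ℕ.+ r ℕ.≤ N → y ∈ ascent i r → i ℕ.< toℕ y × toℕ y ℕ.≤ i ℕ.+ r
  ∈-ascent⁻ {i} {suc r} i+r≤N (here refl)
    rewrite toℕ-pos (ℕ.≤-trans (ℕ.m≤m+n (suc i) r) (subst (ℕ._≤ N) (ℕ.+-suc i r) i+r≤N)) =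
    ℕ.n<1+n i , subst (suc i ℕ.≤_) (sym (ℕ.+-suc i r)) (ℕ.m≤m+n (suc i) r)
  ∈-ascent⁻ {i} {suc r} {y} i+r≤N (there y∈)
    with ∈-ascent⁻ {suc i} {r} (subst (ℕ._≤ N) (ℕ.+-suc i r) i+r≤N) y∈
  ... | si<y , y≤ = ℕ.<-trans (ℕ.n<1+n i) si<y , subst (toℕ y ℕ.≤_) (sym (ℕ.+-suc i r)) y≤

  ∈-ascent⁺ : ∀ {i r} y → i ℕ.< toℕ y → toℕ y ℕ.≤ i ℕ.+ r → y ∈ ascent i r
  ∈-ascent⁺ {i} {zero} y i<y y≤i+0 = contradiction (subst (toℕ y ℕ.≤_) (ℕ.+-identityʳ i) y≤i+0) (ℕ.<⇒≱ i<y)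
  ∈-ascent⁺ {i} {suc r} y i<y y≤ with toℕ y ℕ.≟ suc i
  ... | yes y≡si = here (trans (sym (pos-toℕ y)) (cong pos y≡si))
  ... | no y≢si = there (∈-ascent⁺ y (ℕ.≤∧≢⇒< i<y (y≢si ∘ sym)) (subst (toℕ y ℕ.≤_) (ℕ.+-suc i r) y≤))

  ∈-descent⁻ : ∀ {j y} → y ∈ descent j → toℕ y ℕ.< j
  ∈-descent⁻ {suc j} (here refl) = s≤s (ℕ.≤-trans (ℕ.≤-reflexive (toℕ-fromℕ< _)) (ℕ.m⊓n≤m j N))
  ∈-descent⁻ {suc j} (there y∈) = ℕ.m<n⇒m<1+n (∈-descent⁻ y∈)

  ∈-descent⁺ : ∀ {j} y → toℕ y ℕ.< j → y ∈ descent j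
  ∈-descent⁺ {suc j} y y<sj with toℕ y ℕ.≟ j
  ... | yes y≡j = here (trans (sym (pos-toℕ y)) (cong pos y≡j))
  ... | no y≢j = there (∈-descent⁺ y (ℕ.≤∧≢⇒< (ℕ.≤-pred y<sj) y≢j))

  ascent-unique : ∀ i r → i ℕ.+ r ℕ.≤ N → Unique (ascent i r)
  ascent-unique i zero _ = []
  ascent-unique i (suc r) i+r≤N = All.tabulate fresh ∷ ascent-unique (suc i) r i+sr≤N
    where
    i+sr≤N : suc i ℕ.+ r ℕ.≤ N
    i+sr≤N = subst (ℕ._≤ N) (ℕ.+-suc i r) i+r≤N
    fresh : ∀ {y} → y ∈ ascent (suc i) r → pos (suc i) ≢ y
    fresh y∈ refl =
      ℕ.<-irrefl (sym (toℕ-pos (ℕ.≤-trans (ℕ.m≤m+n (suc i) r) i+sr≤N))) (proj₁ (∈-ascent⁻ i+sr≤N y∈))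

  length-ascent : ∀ i r → length (ascent i r) ≡ r
  length-ascent i zero = refl
  length-ascent i (suc r) = cong suc (length-ascent (suc i) r)

  visited : ℕ → List V
  visited i = descent (suc i)

  ∉-visited : ∀ {i y} → y ∉ visited i → i ℕ.< toℕ y
  ∉-visited {i} {y} y∉ = ℕ.≰⇒> λ y≤i → y∉ (∈-descent⁺ y (s≤s y≤i))

  unvisited : ∀ {i y} → i ℕ.< toℕ y → y ∉ visited i
  unvisited i<y y∈ = ℕ.<⇒≱ i<y (ℕ.≤-pred (∈-descent⁻ y∈))

  -- After the algorithm has visited 0, …, i the top is e_{i+1}, …, e_k, d_{k-1}, …, d_{i+1} and
  -- the gate is d_i; for i = 0 and i ≥ k the top is empty.
  Top : ℕ → V → Set
  Top i x = 1 ℕ.≤ i × i ℕ.< toℕ x × toℕ x ℕ.+ i ℕ.< N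

  top? : ∀ i x → Dec (Top i x)
  top? i x = 1 ℕ.≤? i ×-dec i ℕ.<? toℕ x ×-dec toℕ x ℕ.+ i ℕ.<? N

  gate : ℕ → V
  gate i = pos (N ℕ.∸ i)

  next-top : ∀ {i} → 1 ℕ.≤ i → i ℕ.< k → Top i (pos (suc i))
  next-top {i} 1≤i i<k =
    1≤i , subst (i ℕ.<_) (sym next) (ℕ.n<1+n i) , subst (λ z → z ℕ.+ i ℕ.< N) (sym next) (ℕ.+-mono-≤-< i<k i<k)
    where
    next : toℕ (pos (suc i)) ≡ suc i
    next = toℕ-pos (ℕ.≤-trans i<k (ℕ.m≤m+n k k))

  top-exit-at : ∀ i {x y} → Top i x → adj x y ≡ true → y ∉ visited i → ¬ Top i y → y ≡ gate i
  top-exit-at i {x} {y} (1≤i , i<x , x+i<N) x~y y∉ ¬top = trans (sym (pos-toℕ y)) (cong pos y≡N∸i)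
    where
    i<y : i ℕ.< toℕ y
    i<y = ∉-visited y∉
    N≤y+i : N ℕ.≤ toℕ y ℕ.+ i
    N≤y+i = ℕ.≮⇒≥ λ y+i<N → ¬top (1≤i , i<y , y+i<N)
    y≡N∸i : toℕ y ≡ N ℕ.∸ i
    y≡N∸i = trans (sym (ℕ.m+n∸n≡m (toℕ y) i)) (cong (ℕ._∸ i) (top-exit i<x x+i<N i<y N≤y+i (adjacent x~y)))

  top-sealed-at : ∀ i {x y} → Top i x → y ∈ visited i → ¬ CheapEdge x y
  top-sealed-at i (1≤i , i<x , x+i<N) y∈ = top-sealed 1≤i i<x x+i<N (ℕ.≤-pred (∈-descent⁻ y∈))

  t-not-top : ∀ i → ¬ Top i (pos N)
  t-not-top i (_ , _ , N+i<N) =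
    ℕ.<⇒≱ N+i<N (subst (λ z → N ℕ.≤ z ℕ.+ i) (sym (toℕ-pos ℕ.≤-refl)) (ℕ.m≤m+n N i))

  zig : ℕ → List V
  zig zero = []
  zig (suc j) = pos (suc j) ∷ pos (N ℕ.∸ j) ∷ zig j


  zig-steps : ∀ j → j ℕ.< k → Steps adj (pos (N ℕ.∸ j)) (zig j)
  zig-steps zero _ = tt
  zig-steps (suc j) sj<k =
    proj₂ (cheap-adj sj≤N (ℕ.m∸n≤m N (suc j)) (zig-rung sj<k)) ,
    proj₁ (cheap-adj sj≤N (ℕ.m∸n≤m N j) (zig-brace (ℕ.<-trans (ℕ.n<1+n j) sj<k))) ,
    zig-steps j (ℕ.<-trans (ℕ.n<1+n j) sj<k)
    where
    sj≤N : suc j ℕ.≤ N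
    sj≤N = ℕ.≤-trans (ℕ.<⇒≤ sj<k) (ℕ.m≤m+n k k)

  zig-tour-steps : Steps adj (pos 0) (zig k)
  zig-tour-steps =
    dec-true (adjacent? (pos 0) (pos k)) (inj₁ (subst (Link 0) (sym (toℕ-pos (ℕ.m≤m+n k k))) chord)) ,
    proj₁ (cheap-adj (ℕ.m≤m+n k k) (ℕ.m∸n≤m N (suc m)) (zig-brace (ℕ.n<1+n (suc m)))) ,
    zig-steps (suc m) (ℕ.n<1+n (suc m))

  zig-end : ∀ j → endAt (pos (N ℕ.∸ j)) (zig j) ≡ pos N
  zig-end zero = refl
  zig-end (suc j) = zig-end j

  ∈-zig : ∀ {j} y → (1 ℕ.≤ toℕ y × toℕ y ℕ.≤ j) ⊎ N ℕ.< toℕ y ℕ.+ j → y ∈ zig j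
  ∈-zig {zero} y (inj₁ (1≤y , y≤0)) = contradiction (ℕ.≤-trans 1≤y y≤0) λ ()
  ∈-zig {zero} y (inj₂ N<y+0) =
    contradiction (subst (N ℕ.<_) (ℕ.+-identityʳ (toℕ y)) N<y+0) (ℕ.≤⇒≯ (toℕ≤pred[n] y))
  ∈-zig {suc j} y range with toℕ y ℕ.≟ suc j | toℕ y ℕ.≟ N ℕ.∸ j
  ... | yes y≡sj | _ = here (trans (sym (pos-toℕ y)) (cong pos y≡sj))
  ... | no _ | yes y≡N∸j = there (here (trans (sym (pos-toℕ y)) (cong pos y≡N∸j)))
  ... | no y≢sj | no y≢N∸j = there (there (∈-zig y (narrow range)))
    where
    narrow : (1 ℕ.≤ toℕ y × toℕ y ℕ.≤ suc j) ⊎ N ℕ.< toℕ y ℕ.+ suc j →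
             (1 ℕ.≤ toℕ y × toℕ y ℕ.≤ j) ⊎ N ℕ.< toℕ y ℕ.+ j
    narrow (inj₁ (1≤y , y≤sj)) = inj₁ (1≤y , ℕ.≤-pred (ℕ.≤∧≢⇒< y≤sj y≢sj))
    narrow (inj₂ N<y+sj) = inj₂ (ℕ.≤∧≢⇒< (ℕ.≤-pred (subst (N ℕ.<_) (ℕ.+-suc (toℕ y) j) N<y+sj)) N≢y+j)
      where
      N≢y+j : N ≢ toℕ y ℕ.+ j
      N≢y+j N≡y+j = y≢N∸j (trans (sym (ℕ.m+n∸n≡m (toℕ y) j)) (cong (ℕ._∸ j) (sym N≡y+j)))

  zig-covers : ∀ x → x ∈ pos 0 ∷ zig k
  zig-covers x with toℕ x ℕ.≟ 0 | toℕ x ℕ.≤? k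
  ... | yes x≡0 | _ = here (trans (sym (pos-toℕ x)) (cong pos x≡0))
  ... | no x≢0 | yes x≤k = there (∈-zig x (inj₁ (ℕ.n≢0⇒n>0 x≢0 , x≤k)))
  ... | no _ | no x≰k = there (∈-zig x (inj₂ (ℕ.+-monoˡ-< k (ℕ.≰⇒> x≰k))))

module Ladder (m : ℕ) {α : ℚ} (1≤α : 1ℚ ≤ α) (α≤2 : α ≤ 2ℚ) where

  open LadderGraph m public

  w : V → V → ℚ
  w x y = if does (cheapEdge? x y) then 1ℚ else α

  w-cheap : ∀ {x y} → CheapEdge x y → w x y ≡ 1ℚ
  w-cheap {x} {y} c rewrite dec-true (cheapEdge? x y) c = refl

  w-dear : ∀ {x y} → ¬ CheapEdge x y → w x y ≡ α
  w-dear {x} {y} ¬c rewrite dec-false (cheapEdge? x y) ¬c = refl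

  w-sym : ∀ x y → w x y ≡ w y x
  w-sym x y = cong (if_then 1ℚ else α) (∨-comm (does (cheap? (toℕ x) (toℕ y))) (does (cheap? (toℕ y) (toℕ x))))

  w-≥1 : ∀ x y → 1ℚ ≤ w x y
  w-≥1 x y with does (cheapEdge? x y)
  ... | true = ℚ.≤-refl
  ... | false = 1≤α

  w-≤α : ∀ x y → w x y ≤ α
  w-≤α x y with does (cheapEdge? x y)
  ... | true = 1≤α
  ... | false = ℚ.≤-refl

  s≢t : pos 0 ≢ pos N
  s≢t eq = contradiction (trans (cong toℕ eq) (toℕ-pos ℕ.≤-refl)) λ ()

  connected : ∀ x y → Σ (List V) λ xs → Steps adj x xs × endAt x xs ≡ y
  connected x y = descent (toℕ x) ++ ascent 0 (toℕ y) , steps-++ (descent (toℕ x)) down up , arrive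
    where
    down : Steps adj x (descent (toℕ x))
    down = subst (λ z → Steps adj z (descent (toℕ x))) (pos-toℕ x) (descent-steps (toℕ x) (toℕ≤pred[n] x))
    bottom : endAt x (descent (toℕ x)) ≡ pos 0
    bottom = subst (λ z → endAt z (descent (toℕ x)) ≡ pos 0) (pos-toℕ x) (descent-end (toℕ x))
    up : Steps adj (endAt x (descent (toℕ x))) (ascent 0 (toℕ y))
    up = subst (λ z → Steps adj z (ascent 0 (toℕ y))) (sym bottom) (ascent-steps 0 (toℕ y) (toℕ≤pred[n] y))
    arrive : endAt x (descent (toℕ x) ++ ascent 0 (toℕ y)) ≡ y
    arrive = trans (endAt-++ x (descent (toℕ x)) (ascent 0 (toℕ y)))
               (trans (cong (λ z → endAt z (ascent 0 (toℕ y))) bottom) (trans (ascent-end 0 (toℕ y)) (pos-toℕ y)))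

  ladder : Instance
  ladder = record
    { n = suc N ; adj = adj ; adj-sym = adj-sym ; adj-irr = adj-irr
    ; lo = λ _ _ → 1ℚ ; up = λ _ _ → α ; w = w
    ; lo-sym = λ _ _ → refl ; up-sym = λ _ _ → refl ; w-sym = w-sym
    ; w-lo = λ x y _ → w-≥1 x y ; w-up = λ x y _ → w-≤α x y
    ; s = pos 0 ; t = pos N ; s≢t = s≢t ; connected = connected }

  announced : Announced ladder α
  announced _ _ _ = refl , refl

  open AnnouncedInstance ladder 1≤α announced

  est-dear : ∀ {vis x y} → ¬ CheapEdge x y → α ≤ est ladder vis x y
  est-dear {vis} {x} {y} ¬c with does (mem? _≟ᶠ_ x vis) ∨ does (mem? _≟ᶠ_ y vis)
  ... | true = ℚ.≤-reflexive (sym (w-dear ¬c))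
  ... | false = ℚ.≤-refl

  top-sealed-est : ∀ i {vis x y} → Top i x → y ∈ visited i → adj x y ≡ true → α ≤ est ladder vis x y
  top-sealed-est i {vis} top y∈ _ = est-dear {vis} (top-sealed-at i top y∈)

  module State (i r : ℕ) (i+1+r≡N : i ℕ.+ suc r ≡ N) where

    vis : List V
    vis = visited i

    f : V → V → ℚ
    f = est ladder vis

    plan : List V
    plan = ascent i (suc r)

    i<N : i ℕ.< N
    i<N = subst (i ℕ.<_) i+1+r≡N (ℕ.m<m+n i ℕ.z<s)

    open Removal (_≟ᶠ_ {suc N})
    open GatePotential adj adj-sym (pos N) f (est-sym vis) 1≤α α≤2
      (λ x → mem? _≟ᶠ_ x vis) cheapEdge?
      (λ {x} {y} → est-≥1 {vis} {x} {y}) (λ {x} {y} _ → est-dear {vis} {x} {y})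
      (λ {x} {y} x~y x∉ y∉ → ℚ.≤-reflexive (sym (est-unrevealed {vis} {x} {y} x~y x∉ y∉)))
      (top? i) (gate i) (λ {x} {y} → top-exit-at i {x} {y}) (λ {x} {y} → top-sealed-est i {vis} {x} {y})
      (t-not-top i)
    open ℚ.≤-Reasoning

    plan-unique : Unique plan
    plan-unique = ascent-unique i (suc r) (ℕ.≤-reflexive i+1+r≡N)

    plan-unvisited : All (_∉ vis) plan
    plan-unvisited = All.tabulate λ y∈ → unvisited (proj₁ (∈-ascent⁻ (ℕ.≤-reflexive i+1+r≡N) y∈))

    ∈-plan : ∀ {v} → v ∉ vis → v ∈ plan
    ∈-plan {v} v∉ = ∈-ascent⁺ v (∉-visited v∉) (subst (toℕ v ℕ.≤_) (sym i+1+r≡N) (toℕ≤pred[n] v))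

    plan-feasible : Feasible ladder vis (pos i) plan
    plan-feasible =
      ascent-steps i (suc r) (ℕ.≤-reflexive i+1+r≡N) ,
      trans (ascent-end i (suc r)) (cong pos i+1+r≡N) ,
      λ _ → there ∘ ∈-plan

    plan-cost : cost f (pos i) plan ≡ w (pos i) (pos (suc i)) + r · α
    plan-cost = cong₂ _+_ (est-revealed {vis} (pos (suc i)) (here refl)) (begin-equality
      cost f (pos (suc i)) (ascent (suc i) r)
        ≡⟨ cost-unrevealed {vis} (ascent (suc i) r) (proj₂ (proj₁ plan-feasible))
                           (All.head plan-unvisited) (All.tail plan-unvisited) ⟩
      length (ascent (suc i) r) · α
        ≡⟨ cong (_· α) (length-ascent (suc i) r) ⟩
      r · α ∎)

    plan-≤ : cost f (pos i) plan ≤ suc r · α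
    plan-≤ = ℚ.≤-trans (ℚ.≤-reflexive plan-cost) (ℚ.+-monoˡ-≤ (r · α) (w-≤α (pos i) (pos (suc i))))

    lower-bound : ∀ {ys} → Feasible ladder vis (pos i) ys → suc r · α + Φ (pos i) plan ≤ cost f (pos i) ys
    lower-bound {ys} feasible = subst (λ l → l · α + Φ (pos i) plan ≤ cost f (pos i) ys) (length-ascent i (suc r))
      (feasible-bound gate-bound (here refl) plan-unique plan-unvisited feasible)

    revisit-bound : ∀ {v ys} → Feasible ladder vis (pos i) (v ∷ ys) → v ∈ vis →
      f (pos i) v + (suc r · α + Φ v plan) ≤ cost f (pos i) (v ∷ ys)
    revisit-bound {v} {ys} feasible v∈ =
      subst (λ l → f (pos i) v + (l · α + Φ v plan) ≤ cost f (pos i) (v ∷ ys))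
        (length-ascent i (suc r)) (detour-visited gate-bound (here refl) plan-unique plan-unvisited feasible v∈)

    advance-bound : ∀ {v ys} → Feasible ladder vis (pos i) (v ∷ ys) → v ∉ vis →
      f (pos i) v + (r · α + Φ v (plan ∖ v)) ≤ cost f (pos i) (v ∷ ys)
    advance-bound {v} {ys} feasible v∉ =
      subst (λ l → f (pos i) v + (l · α + Φ v (plan ∖ v)) ≤ cost f (pos i) (v ∷ ys))
        plan∖v-length (detour-unvisited gate-bound (here refl) plan-unique plan-unvisited feasible)
      where
      plan∖v-length : length (plan ∖ v) ≡ r
      plan∖v-length = ℕ.suc-injective (trans (sym (length-∖ plan-unique (∈-plan v∉))) (length-ascent i (suc r)))

    Φ-plan-≥0 : ¬ CheapEdge (pos i) (pos (suc i)) → 0ℚ ≤ Φ (pos i) plan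
    Φ-plan-≥0 ¬c with ℕ.<-cmp i k
    ... | tri< i<k _ _ = Φ-pending-≥0 (lose (here refl) (next-top (ℕ.n≢0⇒n>0 (¬c ∘ step-cheap i<N ∘ inj₁)) i<k))
    ... | tri≈ _ i≡k _ = contradiction (step-cheap i<N (inj₂ i≡k)) ¬c
    ... | tri> _ _ k<i = ℚ.≤-reflexive (sym (Φ-visited-dear (here refl) no-cheap))
      where
      no-cheap : ¬ Any (CheapEdge (pos i)) plan
      no-cheap any with find any
      ... | y , y∈ , c =
        no-cheap-beyond-turn k<i (ℕ.<⇒≤ i<N) (proj₁ (∈-ascent⁻ (ℕ.≤-reflexive i+1+r≡N) y∈)) c

    plan-≤-bound : cost f (pos i) plan ≤ suc r · α + Φ (pos i) plan
    plan-≤-bound with cheapEdge? (pos i) (pos (suc i))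
    ... | yes c = begin
      cost f (pos i) plan                ≡⟨ plan-cost ⟩
      w (pos i) (pos (suc i)) + r · α    ≡⟨ cong (_+ r · α) (w-cheap c) ⟩
      1ℚ + r · α                         ≡⟨ solve 2 (λ a x → con 1ℚ :+ x := (a :+ x) :+ (con 1ℚ :- a))
                                                    refl α (r · α) ⟩
      suc r · α + (1ℚ - α)               ≤⟨ ℚ.+-monoʳ-≤ (suc r · α) Φ-≥1-α ⟩
      suc r · α + Φ (pos i) plan         ∎
      where open +-*-Solver
    ... | no ¬c = begin
      cost f (pos i) plan                ≡⟨ plan-cost ⟩
      w (pos i) (pos (suc i)) + r · α    ≡⟨ cong (_+ r · α) (w-dear ¬c) ⟩
      suc r · α                          ≡⟨ ℚ.+-identityʳ (suc r · α) ⟨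
      suc r · α + 0ℚ                     ≤⟨ ℚ.+-monoʳ-≤ (suc r · α) (Φ-plan-≥0 ¬c) ⟩
      suc r · α + Φ (pos i) plan         ∎

    plan-move : Move ladder vis (pos i) (pos (suc i))
    plan-move = ascent (suc i) r , plan-feasible , λ _ feasible → ℚ.≤-trans plan-≤-bound (lower-bound feasible)

    module Forced (1<α : 1ℚ < α) (α<2 : α < 2ℚ) where

      0<2-α : 0ℚ < 2ℚ - α
      0<2-α = begin-strict
        0ℚ      ≡⟨ ℚ.+-inverseʳ α ⟨
        α - α   <⟨ ℚ.+-monoˡ-< (- α) α<2 ⟩
        2ℚ - α  ∎

      revisit-gain : ∀ {X e φ} → 1ℚ ≤ e → 1ℚ - α ≤ φ → X < e + (X + φ)
      revisit-gain {X} {e} {φ} 1≤e 1-α≤φ = begin-strict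
        X                    ≡⟨ ℚ.+-identityʳ X ⟨
        X + 0ℚ               <⟨ ℚ.+-monoʳ-< X 0<2-α ⟩
        X + (2ℚ - α)         ≡⟨ solve 2 (λ x a → x :+ (con 2ℚ :- a) := con 1ℚ :+ (x :+ (con 1ℚ :- a)))
                                      refl X α ⟩
        1ℚ + (X + (1ℚ - α))  ≤⟨ ℚ.+-mono-≤ 1≤e (ℚ.+-monoʳ-≤ X 1-α≤φ) ⟩
        e + (X + φ)          ∎
        where open +-*-Solver

      chord-gain : ∀ {X e φ} → α ≤ e → 0ℚ ≤ φ → 1ℚ + X < e + (X + φ)
      chord-gain {X} {e} {φ} α≤e 0≤φ = begin-strict
        1ℚ + X        <⟨ ℚ.+-monoˡ-< X 1<α ⟩
        α + X         ≡⟨ cong (α +_) (ℚ.+-identityʳ X) ⟨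
        α + (X + 0ℚ)  ≤⟨ ℚ.+-mono-≤ α≤e (ℚ.+-monoʳ-≤ X 0≤φ) ⟩
        e + (X + φ)   ∎

      gate-gain : ∀ {X e} → 1ℚ ≤ e → α + X < e + (X + 1ℚ)
      gate-gain {X} {e} 1≤e = begin-strict
        α + X          <⟨ ℚ.+-monoˡ-< X α<2 ⟩
        2ℚ + X         ≡⟨ solve 1 (λ x → con 2ℚ :+ x := con 1ℚ :+ (x :+ con 1ℚ)) refl X ⟩
        1ℚ + (X + 1ℚ)  ≤⟨ ℚ.+-monoˡ-≤ (X + 1ℚ) 1≤e ⟩
        e + (X + 1ℚ)   ∎
        where open +-*-Solver

      detour-costlier : ∀ {v} → v ≢ pos (suc i) → ∀ {ys} → Feasible ladder vis (pos i) (v ∷ ys) →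
        cost f (pos i) plan < cost f (pos i) (v ∷ ys)
      detour-costlier {v} v≢next {ys} feasible@((i~v , _) , _) with mem? _≟ᶠ_ v vis
      ... | yes v∈ = begin-strict
        cost f (pos i) plan                   ≤⟨ plan-≤ ⟩
        suc r · α
          <⟨ revisit-gain {suc r · α} (est-≥1 {vis} {pos i} {v} i~v) (Φ-≥1-α {v} {plan}) ⟩
        f (pos i) v + (suc r · α + Φ v plan)  ≤⟨ revisit-bound feasible v∈ ⟩
        cost f (pos i) (v ∷ ys)               ∎
      ... | no v∉ with forward-neighbour (ℕ.<⇒≤ i<N) i~v (∉-visited v∉)
      ...   | inj₁ v≡next = contradiction (trans (sym (pos-toℕ v)) (cong pos v≡next)) v≢next
      ...   | inj₂ (inj₁ (i≡0 , v≡k)) = begin-strict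
        cost f (pos i) plan                     ≡⟨ plan-cost ⟩
        w (pos i) (pos (suc i)) + r · α         ≡⟨ cong (_+ r · α) (w-cheap (step-cheap i<N (inj₁ i≡0))) ⟩
        1ℚ + r · α
          <⟨ chord-gain {r · α} (est-dear {vis} dear-chord) (Φ-unvisited-≥0 {v} {plan ∖ v} v∉) ⟩
        f (pos i) v + (r · α + Φ v (plan ∖ v))  ≤⟨ advance-bound feasible v∉ ⟩
        cost f (pos i) (v ∷ ys)                 ∎
        where
        dear-chord : ¬ CheapEdge (pos i) v
        dear-chord = chord-not-cheap (trans (toℕ-pos (ℕ.<⇒≤ i<N)) i≡0) v≡k
      ...   | inj₂ (inj₂ (1≤i , i<k , N≤v+i)) = begin-strict
        cost f (pos i) plan                     ≤⟨ plan-≤ ⟩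
        suc r · α                               <⟨ gate-gain {r · α} (est-≥1 {vis} {pos i} {v} i~v) ⟩
        f (pos i) v + (r · α + 1ℚ)              ≡⟨ cong (λ φ → f (pos i) v + (r · α + φ)) bottom ⟨
        f (pos i) v + (r · α + Φ v (plan ∖ v))  ≤⟨ advance-bound feasible v∉ ⟩
        cost f (pos i) (v ∷ ys)                 ∎
        where
        bottom : Φ v (plan ∖ v) ≡ 1ℚ
        bottom = Φ-bottom-pending v∉ (λ (_ , _ , v+i<N) → ℕ.<⇒≱ v+i<N N≤v+i)
          (lose (∈-∖⁺ (here refl) (v≢next ∘ sym)) (next-top 1≤i i<k))

      move-forced : ∀ {v} → Move ladder vis (pos i) v → v ≡ pos (suc i)
      move-forced {v} move with v ≟ᶠ pos (suc i)
      ... | yes v≡next = v≡next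
      ... | no v≢next = ⊥-elim (move-excluded move plan-feasible (detour-costlier v≢next))

  run-from : ∀ i r → i ℕ.+ r ≡ N → Run ladder (visited i) (pos i) (ascent i r)
  run-from i zero i+0≡N =
    done (cong pos i≡N) λ x → ∈-descent⁺ x (s≤s (subst (toℕ x ℕ.≤_) (sym i≡N) (toℕ≤pred[n] x)))
    where
    i≡N : i ≡ N
    i≡N = trans (sym (ℕ.+-identityʳ i)) i+0≡N
  run-from i (suc r) i+1+r≡N =
    step (State.plan-move i r i+1+r≡N) (run-from (suc i) r (trans (sym (ℕ.+-suc i r)) i+1+r≡N))

  alg-run : AlgRun ladder (ascent 0 N)
  alg-run = run-from 0 N refl

  module _ (1<α : 1ℚ < α) (α<2 : α < 2ℚ) where

    run-unique : ∀ i r → i ℕ.+ r ≡ N → ∀ {ms} → Run ladder (visited i) (pos i) ms → ms ≡ ascent i r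
    run-unique i zero _ (done _ _) = refl
    run-unique i zero i+0≡N (step move _) =
      ⊥-elim (no-move-at-end all-visited (subst (λ j → Move ladder (visited j) (pos j) _) i≡N move))
      where
      i≡N : i ≡ N
      i≡N = trans (sym (ℕ.+-identityʳ i)) i+0≡N
      all-visited : ∀ x → x ∈ visited N
      all-visited x = ∈-descent⁺ x (s≤s (toℕ≤pred[n] x))
    run-unique i (suc r) i+1+r≡N (done i≡t _) = contradiction (begin-equality
      i                ≡⟨ toℕ-pos (ℕ.<⇒≤ i<N) ⟨
      toℕ (pos i)      ≡⟨ cong toℕ i≡t ⟩
      toℕ (pos N)      ≡⟨ toℕ-pos ℕ.≤-refl ⟩
      N                ∎) (ℕ.<⇒≢ i<N)
      where
      open ℕ.≤-Reasoning
      i<N : i ℕ.< N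
      i<N = State.i<N i r i+1+r≡N
    run-unique i (suc r) i+1+r≡N (step move run) with State.Forced.move-forced i r i+1+r≡N 1<α α<2 move
    ... | refl = cong (pos (suc i) ∷_) (run-unique (suc i) r (trans (sym (ℕ.+-suc i r)) i+1+r≡N) run)

    alg-run-unique : ∀ {ms} → AlgRun ladder ms → ms ≡ ascent 0 N
    alg-run-unique = run-unique 0 N refl

  cost-dear-ascent : ∀ i r → 1 ℕ.≤ i → i ℕ.+ r ℕ.≤ N → k ℕ.< i ⊎ i ℕ.+ r ℕ.≤ k →
    cost w (pos i) (ascent i r) ≡ r · α
  cost-dear-ascent i zero _ _ _ = refl
  cost-dear-ascent i (suc r) 1≤i i+1+r≤N avoids-turn =
    cong₂ _+_ (w-dear dear) (cost-dear-ascent (suc i) r (ℕ.m≤n⇒m≤1+n 1≤i) i+1+r≤N′ (shift avoids-turn))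
    where
    i+1+r≤N′ : suc i ℕ.+ r ℕ.≤ N
    i+1+r≤N′ = subst (ℕ._≤ N) (ℕ.+-suc i r) i+1+r≤N
    shift : k ℕ.< i ⊎ i ℕ.+ suc r ℕ.≤ k → k ℕ.< suc i ⊎ suc i ℕ.+ r ℕ.≤ k
    shift (inj₁ k<i) = inj₁ (ℕ.m<n⇒m<1+n k<i)
    shift (inj₂ i+1+r≤k) = inj₂ (subst (ℕ._≤ k) (ℕ.+-suc i r) i+1+r≤k)
    i≢k : i ≢ k
    i≢k refl = [ ℕ.<-irrefl refl , ℕ.<⇒≱ (ℕ.m<m+n k ℕ.z<s) ]′ avoids-turn
    dear : ¬ CheapEdge (pos i) (pos (suc i))
    dear c = [ (λ i≡0 → ℕ.<⇒≢ 1≤i (sym i≡0)) , i≢k ]′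
               (step-cheap⁻ (ℕ.≤-trans (ℕ.m<m+n i ℕ.z<s) i+1+r≤N) c)

  alg-cost : algCost ladder (ascent 0 N) ≡ 1ℚ + (suc m · α + (1ℚ + suc m · α))
  alg-cost = cong₂ _+_ (w-cheap (step-cheap N>0 (inj₁ refl)))
    (begin-equality
      cost w (pos 1) (ascent 1 (suc m ℕ.+ k))
        ≡⟨ cong (cost w (pos 1)) (ascent-++ 1 (suc m) k) ⟩
      cost w (pos 1) (ascent 1 (suc m) ++ ascent k k)
        ≡⟨ cost-++ w (pos 1) (ascent 1 (suc m)) (ascent k k) ⟩
      cost w (pos 1) (ascent 1 (suc m)) + cost w (endAt (pos 1) (ascent 1 (suc m))) (ascent k k)
        ≡⟨ cong₂ _+_ (cost-dear-ascent 1 (suc m) ℕ.≤-refl (ℕ.m≤m+n k k) (inj₂ ℕ.≤-refl))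
                     (cong (λ u → cost w u (ascent k k)) (ascent-end 1 (suc m))) ⟩
      suc m · α + cost w (pos k) (ascent k k)
        ≡⟨ cong (suc m · α +_) (cong₂ _+_ (w-cheap (step-cheap (ℕ.m<m+n k ℕ.z<s) (inj₂ refl)))
                                           (cost-dear-ascent (suc k) (suc m) (s≤s z≤n) descent-fits (inj₁ ℕ.≤-refl))) ⟩
      suc m · α + (1ℚ + suc m · α) ∎)
    where
    open ℚ.≤-Reasoning
    N>0 : 0 ℕ.< N
    N>0 = ℕ.z<s
    descent-fits : suc k ℕ.+ suc m ℕ.≤ N
    descent-fits = ℕ.≤-reflexive (cong (suc ∘ suc) (sym (ℕ.+-suc m (suc m))))

  zig-cost : ∀ j → j ℕ.< k → cost w (pos (N ℕ.∸ j)) (zig j) ≡ (j ℕ.+ j) · 1ℚ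
  zig-cost zero _ = refl
  zig-cost (suc j) sj<k = begin-equality
    w (pos (N ℕ.∸ suc j)) (pos (suc j)) + (w (pos (suc j)) (pos (N ℕ.∸ j)) + cost w (pos (N ℕ.∸ j)) (zig j))
      ≡⟨ cong₂ _+_ (w-cheap (proj₂ (cheap-edge sj≤N (ℕ.m∸n≤m N (suc j)) (zig-rung sj<k))))
                   (cong₂ _+_ (w-cheap (proj₁ (cheap-edge sj≤N (ℕ.m∸n≤m N j) (zig-brace j<k)))) (zig-cost j j<k)) ⟩
    1ℚ + (1ℚ + (j ℕ.+ j) · 1ℚ)
      ≡⟨ cong (λ l → 1ℚ + l · 1ℚ) (ℕ.+-suc j j) ⟨
    (suc j ℕ.+ suc j) · 1ℚ ∎
    where
    open ℚ.≤-Reasoning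
    j<k : j ℕ.< k
    j<k = ℕ.<-trans (ℕ.n<1+n j) sj<k
    sj≤N : suc j ℕ.≤ N
    sj≤N = ℕ.≤-trans (ℕ.<⇒≤ sj<k) (ℕ.m≤m+n k k)

  opt-value : ℚ
  opt-value = α + (1ℚ + (suc m ℕ.+ suc m) · 1ℚ)

  zig-tour : Tour ladder (zig k)
  zig-tour = zig-tour-steps , zig-end (suc m) , zig-covers

  zig-tour-cost : cost w (pos 0) (zig k) ≡ opt-value
  zig-tour-cost = cong₂ _+_ (w-dear (chord-not-cheap refl (toℕ-pos (ℕ.m≤m+n k k))))
    (cong₂ _+_ (w-cheap (proj₁ (cheap-edge (ℕ.m≤m+n k k) (ℕ.m∸n≤m N (suc m)) (zig-brace (ℕ.n<1+n (suc m))))))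
               (zig-cost (suc m) (ℕ.n<1+n (suc m))))

  s-outside : ¬ Interior (toℕ (pos 0))
  s-outside (() , _)

  v-outside : ¬ Interior (toℕ (pos 1))
  v-outside (1<1 , _) = ℕ.<-irrefl (sym (toℕ-pos (s≤s z≤n))) 1<1

  t-outside : ¬ Interior (toℕ (pos N))
  t-outside (_ , N<N) = ℕ.<-irrefl (toℕ-pos ℕ.≤-refl) N<N

  crossing-dear : ∀ {x y} → Interior (toℕ x) → ¬ Interior (toℕ y) → y ≢ pos 1 → adj x y ≡ true →
    α ≤ w x y
  crossing-dear {x} {y} (1<x , _) ¬inside-y y≢v _ = ℚ.≤-reflexive (sym (w-dear λ where
      (inj₁ c) → ¬inside-y (proj₂ (cheap-interior c x≢1 y≢1))
      (inj₂ c) → ¬inside-y (proj₁ (cheap-interior c y≢1 x≢1))))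
    where
    x≢1 : toℕ x ≢ 1
    x≢1 x≡1 = ℕ.<-irrefl (sym x≡1) 1<x
    y≢1 : toℕ y ≢ 1
    y≢1 y≡1 = y≢v (trans (sym (pos-toℕ y)) (cong pos y≡1))

  open CutPotential adj adj-sym (pos N) w w-sym 1≤α α≤2 (λ {x} {y} _ → w-≥1 x y)
    (λ x → 1 ℕ.<? toℕ x ×-dec toℕ x ℕ.<? N) (pos 1) v-outside t-outside crossing-dear

  tour-cost-≥ : ∀ {xs} → Tour ladder xs → N · 1ℚ + (α - 1ℚ) ≤ cost w (pos 0) xs
  tour-cost-≥ {xs} (steps , end , covers) = begin
    N · 1ℚ + (α - 1ℚ)
      ≡⟨ cong₂ _+_ (cong (_· 1ℚ) (length-ascent 0 N)) (Φ-outside-pending s-outside (lose pos2∈ inside-pos2)) ⟨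
    length R · 1ℚ + Φ (pos 0) R
      ≤⟨ cut-bound xs steps end R⊆xs (ascent-unique 0 N ℕ.≤-refl) s∉R (All.universal (λ _ → tt) R) ⟩
    cost w (pos 0) xs ∎
    where
    open ℚ.≤-Reasoning
    R : List V
    R = ascent 0 N
    s∉R : pos 0 ∉ R
    s∉R s∈R = ℕ.<-irrefl refl (proj₁ (∈-ascent⁻ ℕ.≤-refl s∈R))
    R⊆xs : R ⊆ xs
    R⊆xs {y} y∈R with covers y
    ... | here refl = contradiction y∈R s∉R
    ... | there y∈xs = y∈xs
    2≤N : 2 ℕ.≤ N
    2≤N = ℕ.≤-trans (s≤s (s≤s z≤n)) (ℕ.m≤m+n k k)
    pos2∈ : pos 2 ∈ R
    pos2∈ = ∈-ascent⁺ (pos 2) (subst (0 ℕ.<_) (sym (toℕ-pos 2≤N)) ℕ.z<s)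
                              (subst (ℕ._≤ N) (sym (toℕ-pos 2≤N)) 2≤N)
    inside-pos2 : Interior (toℕ (pos 2))
    inside-pos2 = subst Interior (sym (toℕ-pos 2≤N)) (ℕ.≤-refl , ℕ.≤-trans (ℕ.n≤1+n 3) (ℕ.+-mono-≤ 2≤k 2≤k))
      where
      2≤k : 2 ℕ.≤ k
      2≤k = s≤s (s≤s z≤n)

  opt-value-≡ : opt-value ≡ N · 1ℚ + (α - 1ℚ)
  opt-value-≡ = begin-equality
    α + (1ℚ + Y)
      ≡⟨ solve 2 (λ a y → a :+ (con 1ℚ :+ y) := (con 1ℚ :+ (con 1ℚ :+ y)) :+ (a :- con 1ℚ)) refl α Y ⟩
    (1ℚ + (1ℚ + Y)) + (α - 1ℚ)
      ≡⟨ cong (λ l → (1ℚ + l · 1ℚ) + (α - 1ℚ)) (ℕ.+-suc (suc m) (suc m)) ⟨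
    N · 1ℚ + (α - 1ℚ) ∎
    where
    open ℚ.≤-Reasoning
    open +-*-Solver
    Y : ℚ
    Y = (suc m ℕ.+ suc m) · 1ℚ

  is-opt : IsOPT ladder opt-value
  is-opt = (zig k , zig-tour , zig-tour-cost) , λ _ tour → ℚ.≤-trans (ℚ.≤-reflexive opt-value-≡) (tour-cost-≥ tour)

  opt-≤-alg : ∀ {ms} → AlgRun ladder ms → opt-value ≤ algCost ladder ms
  opt-≤-alg run = proj₂ is-opt _ (alg-run-tour run)

  opt-value-pos : 0ℚ < opt-value
  opt-value-pos = begin-strict
    0ℚ                     <⟨ ℚ.positive⁻¹ 1ℚ ⟩
    1ℚ                     ≤⟨ 1≤α ⟩
    α                      ≡⟨ ℚ.+-identityʳ α ⟨
    α + 0ℚ                 ≤⟨ ℚ.+-monoʳ-≤ α (ℚ.+-mono-≤ (ℚ.nonNegative⁻¹ 1ℚ) (·1-≥0 (suc m ℕ.+ suc m))) ⟩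
    opt-value              ∎
    where
    open ℚ.≤-Reasoning
    ·1-≥0 : ∀ n → 0ℚ ≤ n · 1ℚ
    ·1-≥0 zero = ℚ.≤-refl
    ·1-≥0 (suc n) = ℚ.+-mono-≤ (ℚ.nonNegative⁻¹ 1ℚ) (·1-≥0 n)

-- Arithmetic

·1-toℚᵘ : ∀ n → toℚᵘ (n · 1ℚ) ℚᵘ.≃ mkℚᵘ (ℤ.+ n) 0
·1-toℚᵘ zero = ℚᵘ.≃-refl
·1-toℚᵘ (suc n) =
  ℚᵘ.≃-trans (ℚ.toℚᵘ-homo-+ 1ℚ (n · 1ℚ)) (ℚᵘ.≃-trans (ℚᵘ.+-congʳ (toℚᵘ 1ℚ) (·1-toℚᵘ n)) (*≡* numerators))
  where
  open ℤ-Solver.+-*-Solver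
  numerators : (ℤ.+ 1 ℤ.* ℤ.+ 1 ℤ.+ ℤ.+ n ℤ.* ℤ.+ 1) ℤ.* ℤ.+ 1 ≡ ℤ.+ suc n ℤ.* (ℤ.+ 1 ℤ.* ℤ.+ 1)
  numerators = solve 1 (λ x → (con (ℤ.+ 1) :* con (ℤ.+ 1) :+ x :* con (ℤ.+ 1)) :* con (ℤ.+ 1)
                             := (con (ℤ.+ 1) :+ x) :* (con (ℤ.+ 1) :* con (ℤ.+ 1))) refl (ℤ.+ n)

below-natural : ∀ q → Σ ℕ λ n → q ≤ n · 1ℚ
below-natural (mkℚ (ℤ.+ p) d _) =
  p , ℚ.toℚᵘ-cancel-≤ (ℚᵘ.≤-respʳ-≃ (ℚᵘ.≃-sym (·1-toℚᵘ p))
                                   (*≤* (ℤ.*-monoˡ-≤-nonNeg (ℤ.+ p) (ℤ.+≤+ (s≤s z≤n)))))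
below-natural q@(mkℚ ℤ.-[1+ _ ] _ _) = 0 , ℚ.<⇒≤ (ℚ.negative⁻¹ q)

archimedean : ∀ T {B} → 0ℚ < B → Σ ℕ λ n → T ≤ (n · 1ℚ) * B
archimedean T {B} 0<B = n , (begin
  T               ≡⟨ T/B*B≡T ⟨
  T * 1/ B * B    ≤⟨ ℚ.*-monoʳ-≤-nonNeg B {{nonNegative (ℚ.<⇒≤ 0<B)}} (proj₂ (below-natural (T * 1/ B))) ⟩
  (n · 1ℚ) * B    ∎)
  where
  open ℚ.≤-Reasoning
  instance
    B≢0 : NonZero B
    B≢0 = ℚ.pos⇒nonZero B {{positive 0<B}}
  n : ℕ
  n = proj₁ (below-natural (T * 1/ B))
  T/B*B≡T : T * 1/ B * B ≡ T
  T/B*B≡T = trans (ℚ.*-assoc T (1/ B) B) (trans (cong (T *_) (ℚ.*-inverseˡ B)) (ℚ.*-identityʳ T))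

ladder-ratio : ∀ {α c} → c < α →
  Σ ℕ λ m → c * (α + (1ℚ + (suc m ℕ.+ suc m) · 1ℚ)) < 1ℚ + (suc m · α + (1ℚ + suc m · α))
ladder-ratio {α} {c} c<α = n , (begin-strict
  c * (α + (1ℚ + (suc n ℕ.+ suc n) · 1ℚ))      ≡⟨ cong (λ y → c * (α + (1ℚ + y))) (×-homo-+ 1ℚ (suc n) (suc n)) ⟩
  c * (α + (1ℚ + (J + J)))                     ≡⟨ ℚ.+-identityʳ _ ⟨
  c * (α + (1ℚ + (J + J))) + 0ℚ                <⟨ ℚ.+-monoʳ-< (c * (α + (1ℚ + (J + J)))) 0<gap+gap ⟩
  c * (α + (1ℚ + (J + J))) + (gap + gap)       ≡⟨ identity ⟩
  1ℚ + (J * α + (1ℚ + J * α))                  ≡⟨ cong₂ (λ x y → 1ℚ + (x + (1ℚ + y))) J*α≡ J*α≡ ⟩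
  1ℚ + (suc n · α + (1ℚ + suc n · α))          ∎)
  where
  open ℚ.≤-Reasoning
  B T J gap : ℚ
  B = α - c
  -- chosen so that the two costs differ by exactly gap + gap
  T = ½ * (c * α + c) - 1ℚ
  0<B : 0ℚ < B
  0<B = begin-strict
    0ℚ     ≡⟨ ℚ.+-inverseʳ c ⟨
    c - c  <⟨ ℚ.+-monoˡ-< (- c) c<α ⟩
    α - c  ∎
  n : ℕ
  n = proj₁ (archimedean T 0<B)
  J = suc n · 1ℚ
  gap = J * B - T
  T<J*B : T < J * B
  T<J*B = begin-strict
    T                     ≤⟨ proj₂ (archimedean T 0<B) ⟩
    (n · 1ℚ) * B          ≡⟨ ℚ.+-identityˡ _ ⟨
    0ℚ + (n · 1ℚ) * B     <⟨ ℚ.+-monoˡ-< _ 0<B ⟩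
    B + (n · 1ℚ) * B      ≡⟨ cong (_+ (n · 1ℚ) * B) (ℚ.*-identityˡ B) ⟨
    1ℚ * B + (n · 1ℚ) * B ≡⟨ ℚ.*-distribʳ-+ B 1ℚ (n · 1ℚ) ⟨
    J * B                 ∎
  0<gap : 0ℚ < gap
  0<gap = begin-strict
    0ℚ     ≡⟨ ℚ.+-inverseʳ T ⟨
    T - T  <⟨ ℚ.+-monoˡ-< (- T) T<J*B ⟩
    gap    ∎
  0<gap+gap : 0ℚ < gap + gap
  0<gap+gap = begin-strict
    0ℚ         ≡⟨ ℚ.+-identityʳ 0ℚ ⟨
    0ℚ + 0ℚ    <⟨ ℚ.+-mono-< 0<gap 0<gap ⟩
    gap + gap  ∎
  identity : c * (α + (1ℚ + (J + J))) + (gap + gap) ≡ 1ℚ + (J * α + (1ℚ + J * α))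
  identity = solve 3 (λ a c j → let g = j :* (a :- c) :- (con ½ :* (c :* a :+ c) :- con 1ℚ) in
                         c :* (a :+ (con 1ℚ :+ (j :+ j))) :+ (g :+ g) := con 1ℚ :+ (j :* a :+ (con 1ℚ :+ j :* a)))
                     refl α c J
    where open +-*-Solver
  J*α≡ : J * α ≡ suc n · α
  J*α≡ = trans (×-assoc-* (suc n) 1ℚ α) (cong (suc n ·_) (ℚ.*-identityˡ α))

theorem5 : (α : ℚ) → 1ℚ ≤ α → α < 2ℚ → (c : ℚ) → c < α →
    Σ Instance λ I → Announced I α
    × (Σ (List (Instance.V I)) λ ms → AlgRun I ms)
    × (∀ ms → AlgRun I ms →
    Σ ℚ λ o → IsOPT I o × c * o < algCost I ms)
theorem5 α 1≤α α<2 c c<α with c ℚ.<? 1ℚ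
... | yes c<1 = ladder , announced , (ascent 0 N , alg-run) , λ _ run → opt-value , is-opt , beaten run
  where
  open Ladder 0 1≤α (ℚ.<⇒≤ α<2)
  beaten : ∀ {ms} → AlgRun ladder ms → c * opt-value < algCost ladder ms
  beaten run = ℚ.<-≤-trans (ℚ.*-monoˡ-<-pos opt-value {{positive opt-value-pos}} c<1)
                           (ℚ.≤-trans (ℚ.≤-reflexive (ℚ.*-identityˡ opt-value)) (opt-≤-alg run))
... | no c≮1 = ladder , announced , (ascent 0 N , alg-run) , λ _ run → opt-value , is-opt , beaten run
  where
  open Ladder (proj₁ (ladder-ratio c<α)) 1≤α (ℚ.<⇒≤ α<2)
  beaten : ∀ {ms} → AlgRun ladder ms → c * opt-value < algCost ladder ms
  beaten run = subst (λ ms → c * opt-value < algCost ladder ms)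
                     (sym (alg-run-unique (ℚ.≤-<-trans (ℚ.≮⇒≥ c≮1) c<α) α<2 run))
                     (subst (c * opt-value <_) (sym alg-cost) (proj₂ (ladder-ratio c<α)))
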